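{- Let $n\in\mathbb{N}^\ast$, with $\boldsymbol{\mathcal{A}}$, $\rho$, $T$, $\mathbf{u}$, $\boldsymbol{\mu}$ as in the context, and set $\mathcal{U}=T\rho(\mathbf{u})$ and $\mathcal{M}=T\rho(\boldsymbol{\mu})$. Then $\mathcal{U}$ and $\mathcal{M}$ are symmetric, and $\mathcal{M}=T\,\mathcal{U}^{ -1}\,T$.
   Context: Fix $n\in\mathbb{N}^\ast$ and define $i\,\mathcal{R}\,j\iff\lfloor n/i\rfloor=\lfloor n/j\rfloor$ on $\mathbb{N}^\ast$; its classes are intervals, the integers $>n$ form the only unbounded class. $\mathcal{S}$ is the set of largest elements of the bounded classes, $s=\#\mathcal{S}$, $\mathcal{S}=\{s_1<\dots<s_s\}$; for $k\in\mathcal{S}$, $k^-$ is its predecessor in $\mathcal{S}$ ($1^-=0$). $\boldsymbol{\mathcal{A}}$ is the free $\mathbb{Z}$-module with basis $\{\mathbf{k}:k\in\mathcal{S}\}$, made into a commutative $\mathbb{Z}$-algebra by: $\mathbf{i}\mathbf{j}=\mathbf{l}$ if $ij\le n$, where $l\in\mathcal{S}$ is the largest element of the class of $ij$, and $\mathbf{i}\mathbf{j}=0$ if $ij>n$. For $\mathbf{a}\in\boldsymbol{\mathcal{A}}$, $\rho(\mathbf{a})$ is the $s\times s$ matrix, indexed by $\mathcal{S}$ in increasing order, of $\mathbf{x}\mapsto\mathbf{a}\mathbf{x}$ in the basis $(\mathbf{k})_{k\in\mathcal{S}}$. $T$ is the $s\times s$ matrix with $T_{s_p,s_q}=1$ if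 $p+q\le s+1$ and $0$ otherwise. $\mathbf{u}=\sum_{k\in\mathcal{S}}(k-k^-)\mathbf{k}$ and $\boldsymbol{\mu}=\sum_{k\in\mathcal{S}}(M(k)-M(k^-))\mathbf{k}$, where $M(x)=\sum_{1\le m\le x}\mu(m)$ is the Mertens function ($M(0)=0$); these are the images of the constant sequence $(1,1,\dots)$ and the Möbius sequence under the map $a\mapsto\sum_{k\in\mathcal{S}}\big(\sum_{\kappa\in\widehat{k}}a_\kappa\big)\mathbf{k}$, $\widehat{k}$ being the class with largest element $k$. -}

module Defs where

open import Data.Nat as ℕ using (ℕ; zero; suc; _≤?_; _≟_)
open import Data.Nat.DivMod using (_/_)
open import Data.Nat.Divisibility using (_∣?_)
open import Data.Nat.Primality using (prime?)
open import Data.Integer as ℤ using (ℤ; +_; -_; _-_)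
open import Data.Fin using (Fin; toℕ)
open import Data.List using (List; []; _∷_; map; upTo; filter; length)
open import Data.Product using (_×_)
open import Relation.Nullary using (¬?; _×-dec_)
open import Relation.Nullary.Decidable using (⌊_⌋)
open import Relation.Binary.PropositionalEquality using (_≡_)
open import Data.Bool using (if_then_else_)

range : ℕ → List ℕ
range m = map suc (upTo m)

-- ⌊n/k⌋ (only used with k ≥ 1)
quot : ℕ → ℕ → ℕ
quot n zero    = 0
quot n (suc k) = n / suc k

nth : List ℕ → ℕ → ℕ
nth []       _       = 0
nth (x ∷ xs) zero    = x
nth (x ∷ xs) (suc i) = nth xs i

lastOr0 : List ℕ → ℕ
lastOr0 []           = 0
lastOr0 (x ∷ [])     = x
lastOr0 (x ∷ y ∷ xs) = lastOr0 (y ∷ xs)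

-- The set S (increasing list): k ∈ [1,n] is the largest element of its
-- (bounded) class iff ⌊n/k⌋ ≠ ⌊n/(k+1)⌋.  The bounded classes are exactly
-- the classes of 1..n.

Slist : ℕ → List ℕ
Slist n = filter (λ k → ¬? (quot n k ≟ quot n (suc k))) (range n)

s : ℕ → ℕ
s n = length (Slist n)

-- s_{p+1}, for p : Fin s (0-indexed)
elt : (n : ℕ) → Fin (s n) → ℕ
elt n p = nth (Slist n) (toℕ p)

-- predecessor k⁻ of s_{p+1} in S (1⁻ = 0)
pre : (n : ℕ) → Fin (s n) → ℕ
pre n p with toℕ p
... | zero  = 0
... | suc i = nth (Slist n) i

classMax : ℕ → ℕ → ℕ
classMax n m = lastOr0 (filter (λ k → quot n k ≟ quot n m) (range n))

ΣF : (k : ℕ) → (Fin k → ℤ) → ℤ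
ΣF zero    f = + 0
ΣF (suc k) f = f Fin.zero ℤ.+ ΣF k (λ i → f (Fin.suc i))

Mat : ℕ → Set
Mat k = Fin k → Fin k → ℤ

_⊗_ : {k : ℕ} → Mat k → Mat k → Mat k
_⊗_ {k} A B i j = ΣF k (λ l → A i l ℤ.* B l j)

_≈M_ : {k : ℕ} → Mat k → Mat k → Set
A ≈M B = ∀ i j → A i j ≡ B i j

Id : {k : ℕ} → Mat k
Id i j = if ⌊ toℕ i ≟ toℕ j ⌋ then + 1 else + 0

Symmetric : {k : ℕ} → Mat k → Set
Symmetric A = ∀ i j → A i j ≡ A j i

-- The algebra 𝒜 : elements are coefficient vectors in the basis (𝐤)_{k∈S}

Elem : ℕ → Set
Elem n = Fin (s n) → ℤ

-- structure constant: coefficient of basis vector p in 𝐫·𝐪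
--   = 1 if r q ≤ n and the largest element of the class of r q is s_p, else 0
mulCoeff : (n : ℕ) → Fin (s n) → Fin (s n) → Fin (s n) → ℤ
mulCoeff n r q p =
  if ⌊ (elt n r ℕ.* elt n q ≤? n) ×-dec (classMax n (elt n r ℕ.* elt n q) ≟ elt n p) ⌋
  then + 1 else + 0

mulA : (n : ℕ) → Elem n → Elem n → Elem n
mulA n a b p = ΣF (s n) (λ r → ΣF (s n) (λ q → a r ℤ.* b q ℤ.* mulCoeff n r q p))

basis : (n : ℕ) → Fin (s n) → Elem n
basis n q = Id q

-- ρ(a): matrix of x ↦ a x ; column q = coordinates of a·𝐪
ρ : (n : ℕ) → Elem n → Mat (s n)
ρ n a p q = mulA n a (basis n q) p

-- T_{s_p, s_q} = 1 iff p + q ≤ s + 1 (1-indexed); here 0-indexed: p + q < s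
T : (n : ℕ) → Mat (s n)
T n p q = if ⌊ suc (toℕ p ℕ.+ toℕ q) ≤? s n ⌋ then + 1 else + 0

-- μ(m) = 0 if p² ∣ m for some prime p, otherwise (-1)^(number of primes dividing m)
-- (μ(0) := 0, never used)
möbius : ℕ → ℤ
möbius zero = + 0
möbius m@(suc _) =
  if ⌊ length (filter (λ p → prime? p ×-dec (p ℕ.* p ∣? m)) (range m)) ≟ 0 ⌋
  then (- (+ 1)) ℤ.^ length (filter (λ p → prime? p ×-dec (p ∣? m)) (range m))
  else + 0

mertens : ℕ → ℤ
mertens zero    = + 0
mertens (suc x) = mertens x ℤ.+ möbius (suc x)

uvec : (n : ℕ) → Elem n
uvec n p = + elt n p - + pre n p

μvec : (n : ℕ) → Elem n
μvec n p = mertens (elt n p) - mertens (pre n p)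

𝒰 : (n : ℕ) → Mat (s n)
𝒰 n = T n ⊗ ρ n (uvec n)

ℳ : (n : ℕ) → Mat (s n)
ℳ n = T n ⊗ ρ n (μvec n)

-- Since k ↦ ⌊n/k⌋ reverses the order of S, s_p s_q ≤ n iff p + q ≤ s + 1, i.e. T_{s_p,s_q} = 1.
-- The coordinates of 𝐮 and 𝛍 are sums of the sequences over the classes, and ⌊n/·⌋ is constant
-- on each class, so pairing them with a function of ⌊n/·⌋ unfolds to a sum over 1 ≤ m ≤ n.
-- This gives (T ρ(𝐚))_{pq} = Σ_r a_r [s_p s_r s_q ≤ n], symmetric in p and q,
--   𝒰_{pq} = ⌊n/(s_p s_q)⌋   and   (𝒰 ρ(𝛍))_{pq} = Σ_{m ≤ X} μ(m) ⌊X/m⌋ = [X ≥ 1] = T_{pq}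
-- for X = ⌊n/(s_p s_q)⌋, by Möbius inversion. T is invertible (its inverse is the difference
-- of two anti-diagonals), so V = T⁻¹ ℳ T⁻¹ = ρ(𝛍) T⁻¹ is a right inverse of 𝒰, hence an inverse
-- as both are symmetric.
module Submission where

open import Defs
open import Data.Nat as ℕ using (ℕ; zero; suc; _≤_; _<_; z≤n; s≤s; _∸_; _≤?_; _≟_)
import Data.Nat.Properties as ℕP
open import Data.Fin using (Fin; zero; suc; toℕ)
import Data.Fin as Fin
import Data.Fin.Properties as FinP
open import Data.Integer using (ℤ; +_; -_; _+_; _-_; _*_; _^_)
import Data.Integer.Properties as ℤP
open import Data.Integer.Tactic.RingSolver using (solve-∀)
open import Algebra.Properties.Ring ℤP.+-*-ring using (x[y-z]≈xy-xz)
open import Data.Bool using (if_then_else_)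
open import Data.Empty using (⊥-elim)
open import Data.Product using (_×_; _,_; proj₁; proj₂; Σ-syntax)
open import Data.Sum using (inj₁; inj₂)
open import Data.List using (List; []; _∷_; _++_; map; filter; length; upTo; applyUpTo; reverse)
import Data.List.Properties as LP
open import Data.List.Relation.Unary.All as All using (All; []; _∷_)
open import Data.List.Relation.Unary.Any using (here; there)
import Data.List.Relation.Unary.Any.Properties as AnyP
open import Data.List.Relation.Unary.AllPairs using (AllPairs; []; _∷_)
import Data.List.Relation.Unary.AllPairs.Properties as APP
open import Data.List.Membership.Propositional using (_∈_)
import Data.List.Membership.Propositional.Properties as MP
open import Data.Nat.Divisibility using (_∣_; _∣?_; divides; ∣m+n∣m⇒∣n; ∣⇒≤; ∣-trans; m∣m*n; n∣m*n; *-monoʳ-∣; *-cancelˡ-∣)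
open import Data.Nat.DivMod using (_/_; m/n/o≡m/[n*o]; /-monoʳ-≤; m/n≤m; n/n≡1; m*n/n≡m; /-monoˡ-≤; m<n*o⇒m/o<n; m/n*n≤m; m%n<n; m≡m%n+[m/n]*n; m<n⇒m/n≡0)
open import Data.Nat.Coprimality using (Coprime; coprime-divisor)
open import Data.Nat.Primality using (Prime; prime?; euclidsLemma; prime⇒irreducible; prime⇒nonZero; ¬prime[0]; ¬prime[1])
open import Data.Nat.Primality.Factorisation using (PrimeFactorisation; factorise; factors)
open import Data.Nat.ListAction using (product)
open import Level using (0ℓ)
import Relation.Unary as U
open import Relation.Unary using (Pred)
open import Relation.Binary.Bundles using (Setoid)
open import Relation.Binary.Definitions using (tri<; tri≈; tri>)
open import Relation.Binary.PropositionalEquality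
open import Relation.Nullary using (¬_; ¬?; Dec; yes; no; _×-dec_)
open import Relation.Nullary.Decidable using (⌊_⌋; decidable-stable)
open import Function using (_∘_; id; flip; case_of_; _⇔_; mk⇔; Equivalence)

𝟙 : {P : Set} → Dec P → ℤ
𝟙 d = if ⌊ d ⌋ then + 1 else + 0

if-yes : ∀ {P A : Set} {x y : A} (d : Dec P) → P → (if ⌊ d ⌋ then x else y) ≡ x
if-yes (yes _) _ = refl
if-yes (no ¬p) p = ⊥-elim (¬p p)

if-no : ∀ {P A : Set} {x y : A} (d : Dec P) → ¬ P → (if ⌊ d ⌋ then x else y) ≡ y
if-no (yes p) ¬p = ⊥-elim (¬p p)
if-no (no _)  _  = refl

𝟙-yes : ∀ {P : Set} (d : Dec P) → P → 𝟙 d ≡ + 1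
𝟙-yes = if-yes

𝟙-no : ∀ {P : Set} (d : Dec P) → ¬ P → 𝟙 d ≡ + 0
𝟙-no = if-no

𝟙-cong : ∀ {P Q : Set} (d : Dec P) (e : Dec Q) → (P → Q) → (Q → P) → 𝟙 d ≡ 𝟙 e
𝟙-cong d e to from with d
... | yes p = sym (𝟙-yes e (to p))
... | no ¬p = sym (𝟙-no e (λ q → ¬p (from q)))

-- Finite sums and matrices

ΣF-cong : ∀ k {f g : Fin k → ℤ} → (∀ i → f i ≡ g i) → ΣF k f ≡ ΣF k g
ΣF-cong zero    f≗g = refl
ΣF-cong (suc k) f≗g = cong₂ _+_ (f≗g zero) (ΣF-cong k (λ i → f≗g (suc i)))

ΣF-zero : ∀ k {f : Fin k → ℤ} → (∀ i → f i ≡ + 0) → ΣF k f ≡ + 0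
ΣF-zero zero    f≗0 = refl
ΣF-zero (suc k) f≗0 = cong₂ _+_ (f≗0 zero) (ΣF-zero k (λ i → f≗0 (suc i)))

ΣF-distrib-+ : ∀ k (f g : Fin k → ℤ) → ΣF k (λ i → f i + g i) ≡ ΣF k f + ΣF k g
ΣF-distrib-+ zero    f g = refl
ΣF-distrib-+ (suc k) f g =
  trans (cong (_+_ (f zero + g zero)) (ΣF-distrib-+ k (λ i → f (suc i)) (λ i → g (suc i))))
        (interchange (f zero) (g zero) (ΣF k (λ i → f (suc i))) (ΣF k (λ i → g (suc i))))
  where
  interchange : ∀ a b c d → a + b + (c + d) ≡ a + c + (b + d)
  interchange = solve-∀

*-distribˡ-ΣF : ∀ k c (f : Fin k → ℤ) → ΣF k (λ i → c * f i) ≡ c * ΣF k f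
*-distribˡ-ΣF zero    c f = sym (ℤP.*-zeroʳ c)
*-distribˡ-ΣF (suc k) c f =
  trans (cong (_+_ (c * f zero)) (*-distribˡ-ΣF k c (λ i → f (suc i))))
        (sym (ℤP.*-distribˡ-+ c _ _))

*-distribʳ-ΣF : ∀ k c (f : Fin k → ℤ) → ΣF k (λ i → f i * c) ≡ ΣF k f * c
*-distribʳ-ΣF k c f =
  trans (ΣF-cong k (λ i → ℤP.*-comm (f i) c)) (trans (*-distribˡ-ΣF k c f) (ℤP.*-comm c _))

ΣF-comm : ∀ k m (f : Fin k → Fin m → ℤ) →
          ΣF k (λ i → ΣF m (f i)) ≡ ΣF m (λ j → ΣF k (λ i → f i j))
ΣF-comm zero    m f = sym (ΣF-zero m (λ _ → refl))
ΣF-comm (suc k) m f =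
  trans (cong (_+_ (ΣF m (f zero))) (ΣF-comm k m (λ i → f (suc i))))
        (sym (ΣF-distrib-+ m (f zero) (λ j → ΣF k (λ i → f (suc i) j))))

ΣF-single : ∀ k {f : Fin k → ℤ} i → (∀ j → j ≢ i → f j ≡ + 0) → ΣF k f ≡ f i
ΣF-single (suc k) {f} zero others =
  trans (cong (_+_ (f zero)) (ΣF-zero k (λ j → others (suc j) (λ ())))) (ℤP.+-identityʳ _)
ΣF-single (suc k) (suc i) others =
  trans (cong₂ _+_ (others zero (λ ())) (ΣF-single k i (λ j j≢i → others (suc j) (j≢i ∘ FinP.suc-injective))))
        (ℤP.+-identityˡ _)

ΣF-single-toℕ : ∀ k (h : ℕ → ℤ) {m} → m < k → (∀ x → x ≢ m → h x ≡ + 0) →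
                ΣF k (λ l → h (toℕ l)) ≡ h m
ΣF-single-toℕ k h {m} m<k others =
  trans (ΣF-single k (Fin.fromℕ< m<k) (λ l l≢ → others (toℕ l) (l≢ ∘ FinP.toℕ-injective ∘ toℕ-≡ l)))
        (cong h (FinP.toℕ-fromℕ< m<k))
  where
  toℕ-≡ : ∀ l → toℕ l ≡ m → toℕ l ≡ toℕ (Fin.fromℕ< m<k)
  toℕ-≡ l e = trans e (sym (FinP.toℕ-fromℕ< m<k))

Mat-setoid : ℕ → Setoid 0ℓ 0ℓ
Mat-setoid k = record
  { Carrier = Mat k ; _≈_ = _≈M_
  ; isEquivalence = record
    { refl = λ i j → refl ; sym = λ e i j → sym (e i j) ; trans = λ e f i j → trans (e i j) (f i j) } }

⊗-congˡ : ∀ {k} {A A′ : Mat k} (B : Mat k) → A ≈M A′ → (A ⊗ B) ≈M (A′ ⊗ B)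
⊗-congˡ {k} B A≈A′ i j = ΣF-cong k (λ l → cong (_* B l j) (A≈A′ i l))

⊗-congʳ : ∀ {k} {B B′ : Mat k} (A : Mat k) → B ≈M B′ → (A ⊗ B) ≈M (A ⊗ B′)
⊗-congʳ {k} A B≈B′ i j = ΣF-cong k (λ l → cong (A i l *_) (B≈B′ l j))

⊗-assoc : ∀ {k} (A B C : Mat k) → ((A ⊗ B) ⊗ C) ≈M (A ⊗ (B ⊗ C))
⊗-assoc {k} A B C i j = begin
  ΣF k (λ l → ΣF k (λ m → A i m * B m l) * C l j)
    ≡⟨ ΣF-cong k (λ l → sym (*-distribʳ-ΣF k (C l j) _)) ⟩
  ΣF k (λ l → ΣF k (λ m → A i m * B m l * C l j))
    ≡⟨ ΣF-comm k k _ ⟩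
  ΣF k (λ m → ΣF k (λ l → A i m * B m l * C l j))
    ≡⟨ ΣF-cong k (λ m → trans (ΣF-cong k (λ l → ℤP.*-assoc (A i m) (B m l) (C l j)))
                              (*-distribˡ-ΣF k (A i m) _)) ⟩
  ΣF k (λ m → A i m * ΣF k (λ l → B m l * C l j)) ∎
  where open ≡-Reasoning

Id-diag : ∀ {k} (i : Fin k) → Id i i ≡ + 1
Id-diag i = 𝟙-yes (toℕ i ≟ toℕ i) refl

Id-off : ∀ {k} {i j : Fin k} → i ≢ j → Id i j ≡ + 0
Id-off {i = i} {j} i≢j = 𝟙-no (toℕ i ≟ toℕ j) (i≢j ∘ FinP.toℕ-injective)

Id-symmetric : ∀ {k} → Symmetric (Id {k})
Id-symmetric i j = 𝟙-cong (toℕ i ≟ toℕ j) (toℕ j ≟ toℕ i) sym sym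

⊗-identityˡ : ∀ {k} (A : Mat k) → (Id ⊗ A) ≈M A
⊗-identityˡ {k} A i j =
  trans (ΣF-single k i (λ l l≢i → trans (cong (_* A l j) (Id-off (l≢i ∘ sym))) (ℤP.*-zeroˡ (A l j))))
        (trans (cong (_* A i j) (Id-diag i)) (ℤP.*-identityˡ (A i j)))

⊗-identityʳ : ∀ {k} (A : Mat k) → (A ⊗ Id) ≈M A
⊗-identityʳ {k} A i j =
  trans (ΣF-single k j (λ l l≢j → trans (cong (A i l *_) (Id-off l≢j)) (ℤP.*-zeroʳ (A i l))))
        (trans (cong (A i j *_) (Id-diag j)) (ℤP.*-identityʳ (A i j)))

⊗-cancelˡ : ∀ {k} (A B C : Mat k) → (A ⊗ B) ≈M Id → (A ⊗ (B ⊗ C)) ≈M C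
⊗-cancelˡ A B C AB≈Id i j =
  trans (sym (⊗-assoc A B C i j)) (trans (⊗-congˡ C AB≈Id i j) (⊗-identityˡ C i j))

⊗-cancelʳ : ∀ {k} (A B C : Mat k) → (A ⊗ B) ≈M Id → ((C ⊗ A) ⊗ B) ≈M C
⊗-cancelʳ A B C AB≈Id i j =
  trans (⊗-assoc C A B i j) (trans (⊗-congʳ C AB≈Id i j) (⊗-identityʳ C i j))

⊗-transpose : ∀ {k} {A B : Mat k} → Symmetric A → Symmetric B → ∀ i j → (A ⊗ B) i j ≡ (B ⊗ A) j i
⊗-transpose {k} {A} {B} sA sB i j =
  ΣF-cong k (λ l → trans (cong₂ _*_ (sA i l) (sB l j)) (ℤP.*-comm (A l i) (B j l)))

⊗-sandwich-symmetric : ∀ {k} {A B : Mat k} → Symmetric A → Symmetric B → Symmetric ((A ⊗ B) ⊗ A)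
⊗-sandwich-symmetric {k} {A} {B} sA sB i j = trans
  (ΣF-cong k (λ l → trans (cong₂ _*_ (⊗-transpose sA sB i l) (sA l j)) (ℤP.*-comm ((B ⊗ A) l i) (A j l))))
  (sym (⊗-assoc A B A j i))

inverseˡ-of-symmetric : ∀ {k} {A B : Mat k} → Symmetric A → Symmetric B →
                        (A ⊗ B) ≈M Id → (B ⊗ A) ≈M Id
inverseˡ-of-symmetric sA sB AB≈Id i j =
  trans (⊗-transpose sB sA i j) (trans (AB≈Id j i) (Id-symmetric j i))

-- The anti-triangular matrix

𝕋 : (k : ℕ) → Mat k
𝕋 k p q = 𝟙 (suc (toℕ p ℕ.+ toℕ q) ≤? k)

𝕋⁻¹ : (k : ℕ) → Mat k
𝕋⁻¹ k p q = 𝟙 (suc (toℕ p ℕ.+ toℕ q) ≟ k) - 𝟙 (toℕ p ℕ.+ toℕ q ≟ k)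

𝕋-symmetric : ∀ k → Symmetric (𝕋 k)
𝕋-symmetric k p q rewrite ℕP.+-comm (toℕ p) (toℕ q) = refl

𝕋⁻¹-symmetric : ∀ k → Symmetric (𝕋⁻¹ k)
𝕋⁻¹-symmetric k p q rewrite ℕP.+-comm (toℕ p) (toℕ q) = refl

ΣF-distrib-- : ∀ k (f g : Fin k → ℤ) → ΣF k (λ i → f i - g i) ≡ ΣF k f - ΣF k g
ΣF-distrib-- k f g =
  trans (ΣF-distrib-+ k f (λ i → - g i))
        (cong (_+_ (ΣF k f)) (trans (ΣF-cong k (λ i → sym (ℤP.-1*i≡-i (g i))))
                                    (trans (*-distribˡ-ΣF k (- + 1) g) (ℤP.-1*i≡-i _))))

𝕋-row-select : ∀ k P {c d} → d ℕ.+ c ≡ k → 1 ≤ c →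
               ΣF k (λ l → 𝟙 (suc (P ℕ.+ toℕ l) ≤? k) * 𝟙 (toℕ l ℕ.+ c ≟ k)) ≡ 𝟙 (suc P ≤? c)
𝕋-row-select k P {c} {d} d+c≡k c≥1 = begin
  ΣF k (λ l → t (toℕ l) * 𝟙 (toℕ l ℕ.+ c ≟ k))
    ≡⟨ ΣF-single-toℕ k (λ x → t x * 𝟙 (x ℕ.+ c ≟ k)) d<k others ⟩
  t d * 𝟙 (d ℕ.+ c ≟ k)
    ≡⟨ trans (cong (t d *_) (𝟙-yes (d ℕ.+ c ≟ k) d+c≡k)) (ℤP.*-identityʳ (t d)) ⟩
  t d
    ≡⟨ 𝟙-cong (suc (P ℕ.+ d) ≤? k) (suc P ≤? c)
              (λ le → ℕP.+-cancelʳ-≤ d (suc P) c (subst (suc P ℕ.+ d ≤_) d+c≡c+d (subst (_ ≤_) (sym d+c≡k) le)))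
              (λ le → subst (suc (P ℕ.+ d) ≤_) (trans (sym d+c≡c+d) d+c≡k) (ℕP.+-monoˡ-≤ d le)) ⟩
  𝟙 (suc P ≤? c) ∎
  where
  open ≡-Reasoning
  t : ℕ → ℤ
  t x = 𝟙 (suc (P ℕ.+ x) ≤? k)
  d+c≡c+d : d ℕ.+ c ≡ c ℕ.+ d
  d+c≡c+d = ℕP.+-comm d c
  d<k : d < k
  d<k = subst (d <_) d+c≡k (ℕP.m<m+n d c≥1)
  others : ∀ x → x ≢ d → t x * 𝟙 (x ℕ.+ c ≟ k) ≡ + 0
  others x x≢d = trans (cong (t x *_) (𝟙-no (x ℕ.+ c ≟ k) (λ e → x≢d (ℕP.+-cancelʳ-≡ c x d (trans e (sym d+c≡k))))))
                       (ℤP.*-zeroʳ (t x))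

𝟙≤-minus-𝟙< : ∀ m n → 𝟙 (suc m ≤? suc n) - 𝟙 (suc m ≤? n) ≡ 𝟙 (m ≟ n)
𝟙≤-minus-𝟙< m n with ℕP.<-cmp m n
... | tri< m<n m≢n _
  rewrite 𝟙-yes (suc m ≤? suc n) (s≤s (ℕP.<⇒≤ m<n))
        | 𝟙-yes (suc m ≤? n) m<n
        | 𝟙-no (m ≟ n) m≢n = refl
... | tri≈ _ m≡n _
  rewrite 𝟙-yes (suc m ≤? suc n) (s≤s (ℕP.≤-reflexive m≡n))
        | 𝟙-no (suc m ≤? n) (ℕP.<-irrefl m≡n)
        | 𝟙-yes (m ≟ n) m≡n = refl
... | tri> _ m≢n n<m
  rewrite 𝟙-no (suc m ≤? suc n) (ℕP.<⇒≱ n<m ∘ ℕ.s≤s⁻¹)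
        | 𝟙-no (suc m ≤? n) (ℕP.<⇒≱ (ℕP.<-trans n<m (ℕP.n<1+n m)))
        | 𝟙-no (m ≟ n) m≢n = refl

𝕋-inverseʳ : ∀ k → (𝕋 k ⊗ 𝕋⁻¹ k) ≈M Id
𝕋-inverseʳ k p q = begin
  ΣF k (λ l → 𝕋 k p l * (a l - b l))          ≡⟨ ΣF-cong k (λ l → x[y-z]≈xy-xz (𝕋 k p l) (a l) (b l)) ⟩
  ΣF k (λ l → 𝕋 k p l * a l - 𝕋 k p l * b l)  ≡⟨ ΣF-distrib-- k _ _ ⟩
  ΣF k (λ l → 𝕋 k p l * a l) - ΣF k (λ l → 𝕋 k p l * b l)
    ≡⟨ cong₂ _-_ first-sum (second-sum q) ⟩
  𝟙 (suc P ≤? suc (toℕ q)) - 𝟙 (suc P ≤? toℕ q)  ≡⟨ 𝟙≤-minus-𝟙< P (toℕ q) ⟩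
  Id p q                                       ∎
  where
  open ≡-Reasoning
  P = toℕ p
  a b : Fin k → ℤ
  a l = 𝟙 (suc (toℕ l ℕ.+ toℕ q) ≟ k)
  b l = 𝟙 (toℕ l ℕ.+ toℕ q ≟ k)
  first-sum : ΣF k (λ l → 𝕋 k p l * a l) ≡ 𝟙 (suc P ≤? suc (toℕ q))
  first-sum =
    trans (ΣF-cong k (λ l → cong (𝕋 k p l *_) (𝟙-cong (suc (toℕ l ℕ.+ toℕ q) ≟ k) (toℕ l ℕ.+ suc (toℕ q) ≟ k)
                                                      (trans (ℕP.+-suc _ _)) (trans (sym (ℕP.+-suc _ _))))))
          (𝕋-row-select k P (ℕP.m∸n+n≡m (FinP.toℕ<n q)) (s≤s z≤n))
  second-sum : ∀ (q′ : Fin k) → ΣF k (λ l → 𝕋 k p l * 𝟙 (toℕ l ℕ.+ toℕ q′ ≟ k)) ≡ 𝟙 (suc P ≤? toℕ q′)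
  second-sum zero =
    trans (ΣF-zero k (λ l → trans (cong (𝕋 k p l *_) (𝟙-no (toℕ l ℕ.+ 0 ≟ k) (l+0≢k l))) (ℤP.*-zeroʳ (𝕋 k p l))))
          (sym (𝟙-no (suc P ≤? 0) λ ()))
    where
    l+0≢k : ∀ l → toℕ l ℕ.+ 0 ≢ k
    l+0≢k l e = ℕP.<⇒≢ (FinP.toℕ<n l) (trans (sym (ℕP.+-identityʳ (toℕ l))) e)
  second-sum q′@(suc _) = 𝕋-row-select k P (ℕP.m∸n+n≡m (ℕP.<⇒≤ (FinP.toℕ<n q′))) (s≤s z≤n)

𝕋-inverseˡ : ∀ k → (𝕋⁻¹ k ⊗ 𝕋 k) ≈M Id
𝕋-inverseˡ k = inverseˡ-of-symmetric (𝕋-symmetric k) (𝕋⁻¹-symmetric k) (𝕋-inverseʳ k)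

-- Sums over 1 ≤ m ≤ N

Σ≤ : ℕ → (ℕ → ℤ) → ℤ
Σ≤ zero    f = + 0
Σ≤ (suc N) f = Σ≤ N f + f (suc N)

Σ≤-cong : ∀ N {f g : ℕ → ℤ} → (∀ m → 1 ≤ m → m ≤ N → f m ≡ g m) → Σ≤ N f ≡ Σ≤ N g
Σ≤-cong zero    f≗g = refl
Σ≤-cong (suc N) f≗g =
  cong₂ _+_ (Σ≤-cong N (λ m 1≤m m≤N → f≗g m 1≤m (ℕP.m≤n⇒m≤1+n m≤N))) (f≗g (suc N) (s≤s z≤n) ℕP.≤-refl)

Σ≤-zero : ∀ N {f : ℕ → ℤ} → (∀ m → 1 ≤ m → m ≤ N → f m ≡ + 0) → Σ≤ N f ≡ + 0
Σ≤-zero N {f} f≗0 = trans (Σ≤-cong N f≗0) (Σ≤-0 N)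
  where
  Σ≤-0 : ∀ N → Σ≤ N (λ _ → + 0) ≡ + 0
  Σ≤-0 zero    = refl
  Σ≤-0 (suc N) = cong (_+ + 0) (Σ≤-0 N)

Σ≤-distrib-+ : ∀ N (f g : ℕ → ℤ) → Σ≤ N (λ m → f m + g m) ≡ Σ≤ N f + Σ≤ N g
Σ≤-distrib-+ zero    f g = refl
Σ≤-distrib-+ (suc N) f g =
  trans (cong (_+ (f (suc N) + g (suc N))) (Σ≤-distrib-+ N f g))
        (interchange (Σ≤ N f) (Σ≤ N g) (f (suc N)) (g (suc N)))
  where
  interchange : ∀ a b c d → a + b + (c + d) ≡ a + c + (b + d)
  interchange = solve-∀

*-distribˡ-Σ≤ : ∀ N c (f : ℕ → ℤ) → Σ≤ N (λ m → c * f m) ≡ c * Σ≤ N f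
*-distribˡ-Σ≤ zero    c f = sym (ℤP.*-zeroʳ c)
*-distribˡ-Σ≤ (suc N) c f =
  trans (cong (_+ c * f (suc N)) (*-distribˡ-Σ≤ N c f)) (sym (ℤP.*-distribˡ-+ c _ _))

*-distribʳ-Σ≤ : ∀ N c (f : ℕ → ℤ) → Σ≤ N (λ m → f m * c) ≡ Σ≤ N f * c
*-distribʳ-Σ≤ N c f =
  trans (Σ≤-cong N (λ m _ _ → ℤP.*-comm (f m) c)) (trans (*-distribˡ-Σ≤ N c f) (ℤP.*-comm c (Σ≤ N f)))

Σ≤-split : ∀ a b (f : ℕ → ℤ) → Σ≤ (a ℕ.+ b) f ≡ Σ≤ a f + Σ≤ b (λ i → f (a ℕ.+ i))
Σ≤-split a zero    f rewrite ℕP.+-identityʳ a = sym (ℤP.+-identityʳ _)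
Σ≤-split a (suc b) f rewrite ℕP.+-suc a b =
  trans (cong (_+ f (suc (a ℕ.+ b))) (Σ≤-split a b f))
        (ℤP.+-assoc (Σ≤ a f) (Σ≤ b (λ i → f (a ℕ.+ i))) (f (suc (a ℕ.+ b))))

Σ≤-interval : ∀ {a c} (g : ℕ → ℤ) → a ≤ c → Σ≤ c g - Σ≤ a g ≡ Σ≤ (c ∸ a) (λ i → g (a ℕ.+ i))
Σ≤-interval {a} {c} g a≤c = begin
  Σ≤ c g - Σ≤ a g                       ≡⟨ cong (λ x → Σ≤ x g - Σ≤ a g) (sym (ℕP.m+[n∸m]≡n a≤c)) ⟩
  Σ≤ (a ℕ.+ (c ∸ a)) g - Σ≤ a g         ≡⟨ cong (_- Σ≤ a g) (Σ≤-split a (c ∸ a) g) ⟩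
  Σ≤ a g + Σ≤ (c ∸ a) (λ i → g (a ℕ.+ i)) - Σ≤ a g  ≡⟨ cancel (Σ≤ a g) _ ⟩
  Σ≤ (c ∸ a) (λ i → g (a ℕ.+ i))       ∎
  where
  open ≡-Reasoning
  cancel : ∀ x y → x + y - x ≡ y
  cancel = solve-∀

Σ≤-truncate : ∀ K N {f : ℕ → ℤ} → K ≤ N → (∀ m → K < m → m ≤ N → f m ≡ + 0) → Σ≤ N f ≡ Σ≤ K f
Σ≤-truncate K N K≤N tail≗0 with ℕP.m≤n⇒m<n∨m≡n K≤N
... | inj₂ refl = refl
Σ≤-truncate K (suc N) {f} K≤N tail≗0 | inj₁ K<1+N =
  trans (cong₂ _+_ (Σ≤-truncate K N (ℕ.s≤s⁻¹ K<1+N) (λ m K<m m≤N → tail≗0 m K<m (ℕP.m≤n⇒m≤1+n m≤N)))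
                   (tail≗0 (suc N) K<1+N ℕP.≤-refl))
        (ℤP.+-identityʳ (Σ≤ K f))

Σ≤-single : ∀ N {f : ℕ → ℤ} {a} → 1 ≤ a → a ≤ N →
            (∀ m → 1 ≤ m → m ≤ N → m ≢ a → f m ≡ + 0) → Σ≤ N f ≡ f a
Σ≤-single N {f} {suc a} _ a≤N others =
  trans (Σ≤-truncate (suc a) N a≤N (λ m a<m m≤N → others m (ℕP.<-trans (s≤s z≤n) a<m) m≤N (ℕP.<⇒≢ a<m ∘ sym)))
        (trans (cong (_+ f (suc a)) (Σ≤-zero a (λ m 1≤m m≤a → others m 1≤m (ℕP.≤-trans m≤a (ℕP.<⇒≤ a≤N)) (ℕP.<⇒≢ (s≤s m≤a)))))
               (ℤP.+-identityˡ (f (suc a))))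

Σ≤-const-1 : ∀ N → Σ≤ N (λ _ → + 1) ≡ + N
Σ≤-const-1 zero    = refl
Σ≤-const-1 (suc N) = trans (cong (_+ + 1) (Σ≤-const-1 N)) (cong +_ (ℕP.+-comm N 1))

Σ≤-count : ∀ {n Y} → Y ≤ n → Σ≤ n (λ m → 𝟙 (m ≤? Y)) ≡ + Y
Σ≤-count {n} {Y} Y≤n =
  trans (Σ≤-truncate Y n Y≤n (λ m Y<m _ → 𝟙-no (m ≤? Y) (ℕP.<⇒≱ Y<m)))
        (trans (Σ≤-cong Y (λ m _ m≤Y → 𝟙-yes (m ≤? Y) m≤Y)) (Σ≤-const-1 Y))

range-suc : ∀ m → range (suc m) ≡ range m ++ suc m ∷ []
range-suc m = trans (cong (map suc) (sym (LP.upTo-∷ʳ m))) (LP.map-++ suc (upTo m) (m ∷ []))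

∈-range⁺ : ∀ {q m} → 1 ≤ q → q ≤ m → q ∈ range m
∈-range⁺ {suc q} _ q<m = MP.∈-map⁺ suc (MP.∈-upTo⁺ q<m)

length-filter-range : ∀ {P : Pred ℕ 0ℓ} (P? : U.Decidable P) N →
                      + length (filter P? (range N)) ≡ Σ≤ N (λ q → 𝟙 (P? q))
length-filter-range P? zero    = refl
length-filter-range P? (suc N) = begin
  + length (filter P? (range (suc N)))
    ≡⟨ cong (λ xs → + length (filter P? xs)) (range-suc N) ⟩
  + length (filter P? (range N ++ suc N ∷ []))
    ≡⟨ cong (λ xs → + length xs) (LP.filter-++ P? (range N) (suc N ∷ [])) ⟩
  + length (filter P? (range N) ++ filter P? (suc N ∷ []))
    ≡⟨ cong +_ (LP.length-++ (filter P? (range N))) ⟩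
  + length (filter P? (range N)) + + length (filter P? (suc N ∷ []))
    ≡⟨ cong₂ _+_ (length-filter-range P? N) (singleton (suc N)) ⟩
  Σ≤ (suc N) (λ q → 𝟙 (P? q)) ∎
  where
  open ≡-Reasoning
  singleton : ∀ x → + length (filter P? (x ∷ [])) ≡ 𝟙 (P? x)
  singleton x with P? x
  ... | yes _ = refl
  ... | no _  = refl

-- Integer division

*≤⇒≤quot : ∀ {c n d} → 1 ≤ d → c ℕ.* d ≤ n → c ≤ quot n d
*≤⇒≤quot {c} {n} {suc d} _ c*d≤n = subst (_≤ n / suc d) (m*n/n≡m c (suc d)) (/-monoˡ-≤ (suc d) c*d≤n)

≤quot⇒*≤ : ∀ {c n d} → 1 ≤ d → c ≤ quot n d → c ℕ.* d ≤ n
≤quot⇒*≤ {c} {n} {suc d} _ c≤n/d = ℕP.≤-trans (ℕP.*-monoˡ-≤ (suc d) c≤n/d) (m/n*n≤m n (suc d))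

≤quot-swap : ∀ {a m N} → 1 ≤ a → 1 ≤ m → a ≤ quot N m → m ≤ quot N a
≤quot-swap {a} {m} {N} 1≤a 1≤m a≤N/m = *≤⇒≤quot 1≤a (subst (_≤ N) (ℕP.*-comm a m) (≤quot⇒*≤ 1≤m a≤N/m))

quot-quot : ∀ a {b c} → 1 ≤ b → 1 ≤ c → quot (quot a b) c ≡ quot a (b ℕ.* c)
quot-quot a {suc b} {suc c} _ _ = m/n/o≡m/[n*o] a (suc b) (suc c)

quot-quot-comm : ∀ n {a b} → 1 ≤ a → 1 ≤ b → quot (quot n a) b ≡ quot (quot n b) a
quot-quot-comm n {a} {b} 1≤a 1≤b =
  trans (quot-quot n 1≤a 1≤b) (trans (cong (quot n) (ℕP.*-comm a b)) (sym (quot-quot n 1≤b 1≤a)))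

quot-antitone : ∀ n {d d′} → 1 ≤ d → d ≤ d′ → quot n d′ ≤ quot n d
quot-antitone n {suc d} {suc d′} _ d≤d′ = /-monoʳ-≤ n d≤d′

quot-≤ : ∀ n d → quot n d ≤ n
quot-≤ n zero    = z≤n
quot-≤ n (suc d) = m/n≤m n (suc d)

quot-< : ∀ {n d} → n < d → quot n d ≡ 0
quot-< {d = suc _} n<d = m<n⇒m/n≡0 n<d

quot-≥1 : ∀ {n d} → 1 ≤ d → d ≤ n → 1 ≤ quot n d
quot-≥1 {n} {d} 1≤d d≤n = *≤⇒≤quot 1≤d (subst (_≤ n) (sym (ℕP.*-identityˡ d)) d≤n)

quot-self : ∀ {n} → 1 ≤ n → quot n n ≡ 1
quot-self {suc n} _ = n/n≡1 (suc n)

≤quot-quot : ∀ {n k} → 1 ≤ k → k ≤ n → k ≤ quot n (quot n k)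
≤quot-quot {n} {k} 1≤k k≤n =
  *≤⇒≤quot (quot-≥1 1≤k k≤n) (subst (_≤ n) (ℕP.*-comm (quot n k) k) (≤quot⇒*≤ 1≤k ℕP.≤-refl))

quot-quot-quot : ∀ {n k} → 1 ≤ k → k ≤ n → quot n (quot n (quot n k)) ≡ quot n k
quot-quot-quot {n} {k} 1≤k k≤n = ℕP.≤-antisym
  (quot-antitone n 1≤k (≤quot-quot 1≤k k≤n))
  (≤quot-quot (quot-≥1 1≤k k≤n) (quot-≤ n k))

/-unique : ∀ {m d q} .{{_ : ℕ.NonZero d}} → q ℕ.* d ≤ m → m < suc q ℕ.* d → m / d ≡ q
/-unique {m} {d} {q} lo hi =
  ℕP.≤-antisym (ℕ.s≤s⁻¹ (m<n*o⇒m/o<n hi)) (subst (_≤ m / d) (m*n/n≡m q d) (/-monoˡ-≤ d lo))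

<[1+m/n]*n : ∀ m n .{{_ : ℕ.NonZero n}} → m < suc (m / n) ℕ.* n
<[1+m/n]*n m n = subst (_< suc (m / n) ℕ.* n) (sym (m≡m%n+[m/n]*n m n)) (ℕP.+-monoˡ-< (m / n ℕ.* n) (m%n<n m n))

suc-/ : ∀ X d .{{_ : ℕ.NonZero d}} → + (suc X / d) ≡ + (X / d) + 𝟙 (d ∣? suc X)
suc-/ X d with d ∣? suc X
... | yes (divides (suc c) 1+X≡) = begin
  + (suc X / d)   ≡⟨ cong (λ x → + (x / d)) 1+X≡ ⟩
  + (suc c ℕ.* d / d)  ≡⟨ cong +_ (m*n/n≡m (suc c) d) ⟩
  + suc c              ≡⟨ cong +_ (ℕP.+-comm 1 c) ⟩
  + (c ℕ.+ 1)          ≡⟨ cong (λ x → + (x ℕ.+ 1)) (sym (/-unique c*d≤X (subst (X <_) 1+X≡ (ℕP.n<1+n X)))) ⟩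
  + (X / d ℕ.+ 1)      ∎
  where
  open ≡-Reasoning
  c*d≤X : c ℕ.* d ≤ X
  c*d≤X = ℕ.s≤s⁻¹ (subst (c ℕ.* d <_) (sym 1+X≡) (ℕP.m<n+m (c ℕ.* d) (ℕP.n≢0⇒n>0 (ℕ.≢-nonZero⁻¹ d))))
... | no d∤1+X = cong +_ (trans (/-unique lo hi) (sym (ℕP.+-identityʳ (X / d))))
  where
  lo : X / d ℕ.* d ≤ suc X
  lo = ℕP.m≤n⇒m≤1+n (m/n*n≤m X d)
  hi : suc X < suc (X / d) ℕ.* d
  hi = ℕP.≤∧≢⇒< (<[1+m/n]*n X d) (λ 1+X≡ → d∤1+X (divides (suc (X / d)) 1+X≡))

-- Primes and the Möbius function

prime≥1 : ∀ {p} → Prime p → 1 ≤ p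
prime≥1 {zero}  p-prime = ⊥-elim (¬prime[0] p-prime)
prime≥1 {suc _} _       = s≤s z≤n

prime-∣-prime : ∀ {p q} → Prime p → Prime q → q ∣ p → q ≡ p
prime-∣-prime p-prime q-prime q∣p with prime⇒irreducible p-prime q∣p
... | inj₁ refl = ⊥-elim (¬prime[1] q-prime)
... | inj₂ q≡p  = q≡p

∃-prime-divisor : ∀ N → 2 ≤ N → Σ[ p ∈ ℕ ] (Prime p × p ∣ N)
∃-prime-divisor N@(suc _) 2≤N =
  first-factor (factors fN) (PrimeFactorisation.isFactorisation fN) (PrimeFactorisation.factorsPrime fN)
  where
  fN = factorise N
  first-factor : ∀ ps → N ≡ product ps → All Prime ps → Σ[ p ∈ ℕ ] (Prime p × p ∣ N)
  first-factor []       N≡1 _            = ⊥-elim (ℕP.<-irrefl (sym N≡1) 2≤N)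
  first-factor (p ∷ ps) N≡∏ps (p-prime ∷ _) = p , p-prime , subst (p ∣_) (sym N≡∏ps) (m∣m*n _)

square-coprime : ∀ {p q} → Prime p → Prime q → q ≢ p → Coprime (q ℕ.* q) p
square-coprime p-prime q-prime q≢p (d∣q*q , d∣p) with prime⇒irreducible p-prime d∣p
... | inj₁ d≡1 = d≡1
... | inj₂ refl with euclidsLemma _ _ p-prime d∣q*q
...   | inj₁ p∣q = ⊥-elim (q≢p (sym (prime-∣-prime q-prime p-prime p∣q)))
...   | inj₂ p∣q = ⊥-elim (q≢p (sym (prime-∣-prime q-prime p-prime p∣q)))

coprime-of-∤ : ∀ {p m} → Prime p → ¬ p ∣ m → Coprime m p
coprime-of-∤ p-prime p∤m (d∣m , d∣p) with prime⇒irreducible p-prime d∣p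
... | inj₁ d≡1 = d≡1
... | inj₂ refl = ⊥-elim (p∤m d∣m)

PrimeDivisor SquareDivisor : ℕ → ℕ → Set
PrimeDivisor  m q = Prime q × q ∣ m
SquareDivisor m q = Prime q × q ℕ.* q ∣ m

primeDivisor? : (m : ℕ) → U.Decidable (PrimeDivisor m)
primeDivisor? m q = prime? q ×-dec (q ∣? m)

squareDivisor? : (m : ℕ) → U.Decidable (SquareDivisor m)
squareDivisor? m q = prime? q ×-dec (q ℕ.* q ∣? m)

ω #squareDivisors : ℕ → ℕ
ω m               = length (filter (primeDivisor? m) (range m))
#squareDivisors m = length (filter (squareDivisor? m) (range m))

SquareFree : ℕ → Set
SquareFree m = ∀ q → ¬ SquareDivisor m q

squareFree⇒#squareDivisors≡0 : ∀ {m} → SquareFree m → #squareDivisors m ≡ 0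
squareFree⇒#squareDivisors≡0 {m} sf =
  cong length (LP.filter-none (squareDivisor? m) {xs = range m} (All.tabulate (λ {q} _ → sf q)))

#squareDivisors≡0⇒squareFree : ∀ {m} → 1 ≤ m → #squareDivisors m ≡ 0 → SquareFree m
#squareDivisors≡0⇒squareFree {m} 1≤m #≡0 q sq@(q-prime , q*q∣m) =
  nonempty (MP.∈-filter⁺ (squareDivisor? m) (∈-range⁺ (prime≥1 q-prime) q≤m) sq) #≡0
  where
  q≤m : q ≤ m
  q≤m = ∣⇒≤ {{ℕ.>-nonZero 1≤m}} (∣-trans (m∣m*n q) q*q∣m)
  nonempty : ∀ {x} {xs : List ℕ} → x ∈ xs → length xs ≢ 0
  nonempty (here _)  ()
  nonempty (there _) ()

möbius-squareFree : ∀ {m} → 1 ≤ m → SquareFree m → möbius m ≡ (- + 1) ^ ω m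
möbius-squareFree {suc m} _ sf = if-yes (#squareDivisors (suc m) ≟ 0) (squareFree⇒#squareDivisors≡0 sf)

möbius-squareful : ∀ {m} → 1 ≤ m → ¬ SquareFree m → möbius m ≡ + 0
möbius-squareful {suc m} 1≤m ¬sf =
  if-no (#squareDivisors (suc m) ≟ 0) (¬sf ∘ #squareDivisors≡0⇒squareFree 1≤m)

squareFree-*⁻ : ∀ p {j} → SquareFree (p ℕ.* j) → SquareFree j
squareFree-*⁻ p sf q (q-prime , q*q∣j) = sf q (q-prime , ∣-trans q*q∣j (n∣m*n p))

squareFree-* : ∀ {p j} → Prime p → ¬ p ∣ j → SquareFree j → SquareFree (p ℕ.* j)
squareFree-* {p} p-prime p∤j sf q (q-prime , q*q∣p*j) with q ≟ p
... | yes refl = p∤j (*-cancelˡ-∣ q {{prime⇒nonZero p-prime}} q*q∣p*j)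
... | no  q≢p  = sf q (q-prime , coprime-divisor (square-coprime p-prime q-prime q≢p) q*q∣p*j)

ω-* : ∀ {p j} → Prime p → 1 ≤ j → ¬ p ∣ j → ω (p ℕ.* j) ≡ suc (ω j)
ω-* {p} {j} p-prime 1≤j p∤j = ℤP.+-injective (begin
  + ω (p ℕ.* j)
    ≡⟨ length-filter-range (primeDivisor? (p ℕ.* j)) (p ℕ.* j) ⟩
  Σ≤ (p ℕ.* j) (λ q → 𝟙 (primeDivisor? (p ℕ.* j) q))
    ≡⟨ Σ≤-cong (p ℕ.* j) (λ q _ _ → split q) ⟩
  Σ≤ (p ℕ.* j) (λ q → 𝟙 (primeDivisor? j q) + 𝟙 (q ≟ p))
    ≡⟨ Σ≤-distrib-+ (p ℕ.* j) _ _ ⟩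
  Σ≤ (p ℕ.* j) (λ q → 𝟙 (primeDivisor? j q)) + Σ≤ (p ℕ.* j) (λ q → 𝟙 (q ≟ p))
    ≡⟨ cong₂ _+_ (Σ≤-truncate j (p ℕ.* j) j≤p*j (λ q j<q _ → 𝟙-no (primeDivisor? j q) (ℕP.<⇒≱ j<q ∘ ∣⇒≤ {{ℕ.>-nonZero 1≤j}} ∘ proj₂)))
                 (Σ≤-single (p ℕ.* j) (prime≥1 p-prime) p≤p*j (λ q _ _ → 𝟙-no (q ≟ p))) ⟩
  Σ≤ j (λ q → 𝟙 (primeDivisor? j q)) + 𝟙 (p ≟ p)
    ≡⟨ cong₂ _+_ (sym (length-filter-range (primeDivisor? j) j)) (𝟙-yes (p ≟ p) refl) ⟩
  + (ω j ℕ.+ 1)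
    ≡⟨ cong +_ (ℕP.+-comm (ω j) 1) ⟩
  + suc (ω j) ∎)
  where
  open ≡-Reasoning
  j≤p*j : j ≤ p ℕ.* j
  j≤p*j = ℕP.m≤n*m j p {{prime⇒nonZero p-prime}}
  p≤p*j : p ≤ p ℕ.* j
  p≤p*j = ℕP.m≤m*n p j {{ℕ.>-nonZero 1≤j}}
  split : ∀ q → 𝟙 (primeDivisor? (p ℕ.* j) q) ≡ 𝟙 (primeDivisor? j q) + 𝟙 (q ≟ p)
  split q with q ≟ p
  ... | yes refl = trans (𝟙-yes (primeDivisor? (p ℕ.* j) p) (p-prime , m∣m*n j))
                         (cong (_+ + 1) (sym (𝟙-no (primeDivisor? j p) (p∤j ∘ proj₂))))
  ... | no  q≢p  = trans (𝟙-cong (primeDivisor? (p ℕ.* j) q) (primeDivisor? j q)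
                                 (λ (q-prime , q∣p*j) → q-prime , q∣j q-prime q∣p*j)
                                 (λ (q-prime , q∣j) → q-prime , ∣-trans q∣j (n∣m*n p)))
                         (sym (ℤP.+-identityʳ _))
    where
    q∣j : Prime q → q ∣ p ℕ.* j → q ∣ j
    q∣j q-prime q∣p*j with euclidsLemma p j q-prime q∣p*j
    ... | inj₁ q∣p = ⊥-elim (q≢p (prime-∣-prime p-prime q-prime q∣p))
    ... | inj₂ q∣j = q∣j

möbius-*-∣ : ∀ {p j} → Prime p → 1 ≤ j → p ∣ j → möbius (p ℕ.* j) ≡ + 0
möbius-*-∣ {p} p-prime 1≤j p∣j =
  möbius-squareful (ℕP.*-mono-≤ (prime≥1 p-prime) 1≤j) (λ sf → sf p (p-prime , *-monoʳ-∣ p p∣j))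

möbius-*-∤ : ∀ {p j} → Prime p → 1 ≤ j → ¬ p ∣ j → möbius (p ℕ.* j) ≡ - möbius j
möbius-*-∤ {p} {j} p-prime 1≤j p∤j with #squareDivisors j ≟ 0
... | yes #≡0 = begin
  möbius (p ℕ.* j)            ≡⟨ möbius-squareFree (ℕP.*-mono-≤ (prime≥1 p-prime) 1≤j) (squareFree-* p-prime p∤j sf) ⟩
  (- + 1) ^ ω (p ℕ.* j)      ≡⟨ cong ((- + 1) ^_) (ω-* p-prime 1≤j p∤j) ⟩
  (- + 1) ^ suc (ω j)        ≡⟨ ℤP.-1*i≡-i _ ⟩
  - ((- + 1) ^ ω j)          ≡⟨ cong -_ (sym (möbius-squareFree 1≤j sf)) ⟩
  - möbius j                 ∎
  where
  open ≡-Reasoning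
  sf : SquareFree j
  sf = #squareDivisors≡0⇒squareFree 1≤j #≡0
... | no #≢0 = trans (möbius-squareful (ℕP.*-mono-≤ (prime≥1 p-prime) 1≤j) (¬sf ∘ squareFree-*⁻ p))
                     (sym (cong -_ (möbius-squareful 1≤j ¬sf)))
  where
  ¬sf : ¬ SquareFree j
  ¬sf = #≢0 ∘ squareFree⇒#squareDivisors≡0

Σ≤-multiples : ∀ p → 1 ≤ p → ∀ K (h : ℕ → ℤ) →
               Σ≤ (K ℕ.* p) (λ m → 𝟙 (p ∣? m) * h m) ≡ Σ≤ K (λ j → h (j ℕ.* p))
Σ≤-multiples p 1≤p zero    h = refl
Σ≤-multiples p 1≤p (suc K) h = begin
  Σ≤ (suc K ℕ.* p) f                              ≡⟨ cong (λ N → Σ≤ N f) (ℕP.+-comm p (K ℕ.* p)) ⟩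
  Σ≤ (K ℕ.* p ℕ.+ p) f                            ≡⟨ Σ≤-split (K ℕ.* p) p f ⟩
  Σ≤ (K ℕ.* p) f + Σ≤ p (λ i → f (K ℕ.* p ℕ.+ i))
    ≡⟨ cong₂ _+_ (Σ≤-multiples p 1≤p K h) (Σ≤-single p 1≤p ℕP.≤-refl not-multiple) ⟩
  Σ≤ K (λ j → h (j ℕ.* p)) + f (K ℕ.* p ℕ.+ p)
    ≡⟨ cong (_+_ (Σ≤ K (λ j → h (j ℕ.* p)))) last ⟩
  Σ≤ (suc K) (λ j → h (j ℕ.* p)) ∎
  where
  open ≡-Reasoning
  f : ℕ → ℤ
  f m = 𝟙 (p ∣? m) * h m
  not-multiple : ∀ i → 1 ≤ i → i ≤ p → i ≢ p → f (K ℕ.* p ℕ.+ i) ≡ + 0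
  not-multiple i 1≤i i≤p i≢p = cong (_* h (K ℕ.* p ℕ.+ i)) (𝟙-no (p ∣? K ℕ.* p ℕ.+ i)
    (λ p∣ → ℕP.<⇒≱ (ℕP.≤∧≢⇒< i≤p i≢p) (∣⇒≤ {{ℕ.>-nonZero 1≤i}} (∣m+n∣m⇒∣n p∣ (n∣m*n K)))))
  last : f (K ℕ.* p ℕ.+ p) ≡ h (suc K ℕ.* p)
  last rewrite ℕP.+-comm (K ℕ.* p) p = trans (cong (_* h (suc K ℕ.* p)) (𝟙-yes (p ∣? suc K ℕ.* p) (n∣m*n (suc K))))
                                            (ℤP.*-identityˡ _)

μ-∣∤ : ℕ → ℕ → ℕ → ℤ
μ-∣∤ p K j = (+ 1 - 𝟙 (p ∣? j)) * (𝟙 (j ∣? K) * möbius j)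

divisor-sum-off-p : ∀ {p} K → Prime p → 1 ≤ K →
  Σ≤ (K ℕ.* p) (λ m → (+ 1 - 𝟙 (p ∣? m)) * (𝟙 (m ∣? K ℕ.* p) * möbius m)) ≡ Σ≤ K (μ-∣∤ p K)
divisor-sum-off-p {p} K p-prime 1≤K =
  trans (Σ≤-truncate K (K ℕ.* p) (ℕP.m≤m*n K p {{prime⇒nonZero p-prime}}) vanish) (Σ≤-cong K (λ m _ _ → agree m))
  where
  ∣Kp⇒∣K : ∀ {m} → ¬ p ∣ m → m ∣ K ℕ.* p → m ∣ K
  ∣Kp⇒∣K {m} p∤m m∣Kp = coprime-divisor (coprime-of-∤ p-prime p∤m) (subst (m ∣_) (ℕP.*-comm K p) m∣Kp)
  vanish : ∀ m → K < m → m ≤ K ℕ.* p → (+ 1 - 𝟙 (p ∣? m)) * (𝟙 (m ∣? K ℕ.* p) * möbius m) ≡ + 0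
  vanish m K<m _ with p ∣? m
  ... | yes _   = ℤP.*-zeroˡ (𝟙 (m ∣? K ℕ.* p) * möbius m)
  ... | no  p∤m = cong (λ x → + 1 * (x * möbius m))
                       (𝟙-no (m ∣? K ℕ.* p) (ℕP.<⇒≱ K<m ∘ ∣⇒≤ {{ℕ.>-nonZero 1≤K}} ∘ ∣Kp⇒∣K p∤m))
  agree : ∀ m → (+ 1 - 𝟙 (p ∣? m)) * (𝟙 (m ∣? K ℕ.* p) * möbius m) ≡ μ-∣∤ p K m
  agree m with p ∣? m
  ... | yes _   = trans (ℤP.*-zeroˡ (𝟙 (m ∣? K ℕ.* p) * möbius m)) (sym (ℤP.*-zeroˡ (𝟙 (m ∣? K) * möbius m)))
  ... | no  p∤m = cong (λ x → + 1 * (x * möbius m))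
                       (𝟙-cong (m ∣? K ℕ.* p) (m ∣? K) (∣Kp⇒∣K p∤m) (λ m∣K → ∣-trans m∣K (m∣m*n p)))

divisor-sum-on-p : ∀ {p} K → Prime p →
  Σ≤ (K ℕ.* p) (λ m → 𝟙 (p ∣? m) * (𝟙 (m ∣? K ℕ.* p) * möbius m)) ≡ Σ≤ K (λ j → - μ-∣∤ p K j)
divisor-sum-on-p {p} K p-prime =
  trans (Σ≤-multiples p (prime≥1 p-prime) K (λ m → 𝟙 (m ∣? K ℕ.* p) * möbius m))
        (Σ≤-cong K (λ j 1≤j _ → term j 1≤j))
  where
  term : ∀ j → 1 ≤ j → 𝟙 (j ℕ.* p ∣? K ℕ.* p) * möbius (j ℕ.* p) ≡ - μ-∣∤ p K j
  term j 1≤j rewrite ℕP.*-comm j p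
    | 𝟙-cong (p ℕ.* j ∣? K ℕ.* p) (j ∣? K)
             (λ pj∣Kp → *-cancelˡ-∣ p {{prime⇒nonZero p-prime}} (subst (p ℕ.* j ∣_) (ℕP.*-comm K p) pj∣Kp))
             (λ j∣K → subst (p ℕ.* j ∣_) (ℕP.*-comm p K) (*-monoʳ-∣ p j∣K))
    with p ∣? j
  ... | yes p∣j rewrite möbius-*-∣ p-prime 1≤j p∣j = zero-case (𝟙 (j ∣? K)) (möbius j)
    where zero-case : ∀ x y → x * + 0 ≡ - ((+ 1 - + 1) * (x * y))
          zero-case = solve-∀
  ... | no  p∤j rewrite möbius-*-∤ p-prime 1≤j p∤j = neg-case (𝟙 (j ∣? K)) (möbius j)
    where neg-case : ∀ x y → x * - y ≡ - ((+ 1 - + 0) * (x * y))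
          neg-case = solve-∀

-- With N = K p, p prime, the divisors of N prime to p are those of K, and a divisor j p
-- with p ∤ j contributes μ(p j) = - μ(j): the two parts cancel.
möbius-divisor-sum : ∀ N → 2 ≤ N → Σ≤ N (λ m → 𝟙 (m ∣? N) * möbius m) ≡ + 0
möbius-divisor-sum N 2≤N with ∃-prime-divisor N 2≤N
... | p , p-prime , divides K refl = begin
  Σ≤ N f                                                      ≡⟨ Σ≤-cong N (λ m _ _ → split (𝟙 (p ∣? m)) (f m)) ⟩
  Σ≤ N (λ m → 𝟙 (p ∣? m) * f m + (+ 1 - 𝟙 (p ∣? m)) * f m)   ≡⟨ Σ≤-distrib-+ N _ _ ⟩
  Σ≤ N (λ m → 𝟙 (p ∣? m) * f m) + Σ≤ N (λ m → (+ 1 - 𝟙 (p ∣? m)) * f m)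
    ≡⟨ cong₂ _+_ (divisor-sum-on-p K p-prime) (divisor-sum-off-p K p-prime 1≤K) ⟩
  Σ≤ K (λ j → - μ-∣∤ p K j) + Σ≤ K (μ-∣∤ p K)                  ≡⟨ sym (Σ≤-distrib-+ K _ _) ⟩
  Σ≤ K (λ j → - μ-∣∤ p K j + μ-∣∤ p K j)                       ≡⟨ Σ≤-zero K (λ j _ _ → ℤP.+-inverseˡ (μ-∣∤ p K j)) ⟩
  + 0                                                         ∎
  where
  open ≡-Reasoning
  f : ℕ → ℤ
  f m = 𝟙 (m ∣? N) * möbius m
  1≤K : 1 ≤ K
  1≤K = ℕP.n≢0⇒n>0 (λ K≡0 → case subst (λ k → 2 ≤ k ℕ.* p) K≡0 2≤N of λ ())
  split : ∀ d x → x ≡ d * x + (+ 1 - d) * x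
  split = solve-∀

Σ≤-möbius-quot-suc : ∀ X → Σ≤ (suc X) (λ m → möbius m * + quot (suc X) m)
                          ≡ Σ≤ X (λ m → möbius m * + quot X m) + Σ≤ (suc X) (λ m → 𝟙 (m ∣? suc X) * möbius m)
Σ≤-möbius-quot-suc X = begin
  Σ≤ (suc X) (λ m → möbius m * + quot (suc X) m)
    ≡⟨ Σ≤-cong (suc X) (λ m 1≤m _ → step m 1≤m) ⟩
  Σ≤ (suc X) (λ m → möbius m * + quot X m + 𝟙 (m ∣? suc X) * möbius m)
    ≡⟨ Σ≤-distrib-+ (suc X) _ _ ⟩
  Σ≤ (suc X) (λ m → möbius m * + quot X m) + Σ≤ (suc X) (λ m → 𝟙 (m ∣? suc X) * möbius m)
    ≡⟨ cong (_+ Σ≤ (suc X) (λ m → 𝟙 (m ∣? suc X) * möbius m))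
            (Σ≤-truncate X (suc X) (ℕP.n≤1+n X) (λ m X<m _ → trans (cong (λ q → möbius m * + q) (quot-< X<m))
                                                                    (ℤP.*-zeroʳ (möbius m)))) ⟩
  Σ≤ X (λ m → möbius m * + quot X m) + Σ≤ (suc X) (λ m → 𝟙 (m ∣? suc X) * möbius m) ∎
  where
  open ≡-Reasoning
  distrib : ∀ a b c → a * (b + c) ≡ a * b + c * a
  distrib = solve-∀
  step : ∀ m → 1 ≤ m → möbius m * + quot (suc X) m ≡ möbius m * + quot X m + 𝟙 (m ∣? suc X) * möbius m
  step (suc d) _ = trans (cong (möbius (suc d) *_) (suc-/ X (suc d)))
                         (distrib (möbius (suc d)) (+ quot X (suc d)) (𝟙 (suc d ∣? suc X)))

Σ≤-möbius-quot : ∀ X → Σ≤ X (λ m → möbius m * + quot X m) ≡ 𝟙 (1 ≤? X)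
Σ≤-möbius-quot zero          = refl
Σ≤-möbius-quot (suc zero)    = refl
Σ≤-möbius-quot (suc (suc X)) =
  trans (Σ≤-möbius-quot-suc (suc X))
        (cong₂ _+_ (Σ≤-möbius-quot (suc X)) (möbius-divisor-sum (suc (suc X)) (s≤s (s≤s z≤n))))

-- Strictly increasing lists

nth-++ˡ : ∀ (xs ys : List ℕ) {i} → i < length xs → nth (xs ++ ys) i ≡ nth xs i
nth-++ˡ (x ∷ xs) ys {zero}  _         = refl
nth-++ˡ (x ∷ xs) ys {suc i} (s≤s i<n) = nth-++ˡ xs ys i<n

nth-++-length : ∀ (xs : List ℕ) y ys → nth (xs ++ y ∷ ys) (length xs) ≡ y
nth-++-length []       y ys = refl
nth-++-length (x ∷ xs) y ys = nth-++-length xs y ys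

nth-reverse : ∀ (xs : List ℕ) {i} → i < length xs → nth (reverse xs) i ≡ nth xs (length xs ∸ suc i)
nth-reverse (x ∷ xs) {i} i<1+n rewrite LP.unfold-reverse x xs with ℕP.m≤n⇒m<n∨m≡n (ℕ.s≤s⁻¹ i<1+n)
... | inj₁ i<n =
  trans (nth-++ˡ (reverse xs) (x ∷ []) (subst (i <_) (sym (LP.length-reverse xs)) i<n))
        (trans (nth-reverse xs i<n) (cong (nth (x ∷ xs)) (sym (ℕP.+-∸-assoc 1 i<n))))
... | inj₂ refl =
  trans (cong (nth (reverse xs ++ x ∷ [])) (sym (LP.length-reverse xs)))
        (trans (nth-++-length (reverse xs) x []) (cong (nth (x ∷ xs)) (sym (ℕP.n∸n≡0 (length xs)))))

nth-map : ∀ (f : ℕ → ℕ) (xs : List ℕ) {i} → i < length xs → nth (map f xs) i ≡ f (nth xs i)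
nth-map f (x ∷ xs) {zero}  _         = refl
nth-map f (x ∷ xs) {suc i} (s≤s i<n) = nth-map f xs i<n

nth-∈ : ∀ (xs : List ℕ) {i} → i < length xs → nth xs i ∈ xs
nth-∈ (x ∷ xs) {zero}  _         = here refl
nth-∈ (x ∷ xs) {suc i} (s≤s i<n) = there (nth-∈ xs i<n)

∈⇒nth : ∀ {x} {xs : List ℕ} → x ∈ xs → Σ[ i ∈ Fin (length xs) ] nth xs (toℕ i) ≡ x
∈⇒nth (here refl) = zero , refl
∈⇒nth (there x∈xs) with ∈⇒nth x∈xs
... | i , nth≡x = suc i , nth≡x

AllPairs-reverse : ∀ {R : ℕ → ℕ → Set} {xs : List ℕ} → AllPairs R xs → AllPairs (flip R) (reverse xs)
AllPairs-reverse {xs = []}     []          = []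
AllPairs-reverse {xs = x ∷ xs} (x~xs ∷ ap) rewrite LP.unfold-reverse x xs =
  APP.++⁺ (AllPairs-reverse ap) (All.[] ∷ [])
          (All.map (λ r → r All.∷ All.[]) (All.tabulate (All.lookup x~xs ∘ AnyP.reverse⁻)))

AllPairs-mapWith : ∀ {P : ℕ → Set} {R R′ : ℕ → ℕ → Set} {xs : List ℕ} →
                   (∀ {a b} → P a → P b → R a b → R′ a b) → All P xs → AllPairs R xs → AllPairs R′ xs
AllPairs-mapWith f []         []          = []
AllPairs-mapWith {P} {R} {R′} f (px ∷ pxs) (x~xs ∷ ap) = row px pxs x~xs ∷ AllPairs-mapWith f pxs ap
  where
  row : ∀ {a ys} → P a → All P ys → All (R a) ys → All (R′ a) ys
  row pa []         []       = []
  row pa (py ∷ pys) (r ∷ rs) = f pa py r ∷ row pa pys rs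

nth-strictMono : ∀ {xs : List ℕ} → AllPairs _<_ xs → ∀ {i j} → i < j → j < length xs → nth xs i < nth xs j
nth-strictMono {x ∷ xs} (x<xs ∷ _)  {zero}  {suc j} _         (s≤s j<n) = All.lookup x<xs (nth-∈ xs j<n)
nth-strictMono {x ∷ xs} (_    ∷ ap) {suc i} {suc j} (s≤s i<j) (s≤s j<n) = nth-strictMono ap i<j j<n

strictlySorted-≡ : ∀ {xs ys : List ℕ} → AllPairs _<_ xs → AllPairs _<_ ys →
                   (∀ {z} → z ∈ xs → z ∈ ys) → (∀ {z} → z ∈ ys → z ∈ xs) → xs ≡ ys
strictlySorted-≡ {[]}     {[]}     _ _ _ _ = refl
strictlySorted-≡ {[]}     {y ∷ ys} _ _ _ ys⊆ with ys⊆ (here refl)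
... | ()
strictlySorted-≡ {x ∷ xs} {[]}     _ _ xs⊆ _ with xs⊆ (here refl)
... | ()
strictlySorted-≡ {x ∷ xs} {y ∷ ys} (x<xs ∷ sxs) (y<ys ∷ sys) xs⊆ ys⊆ =
  cong₂ _∷_ x≡y (strictlySorted-≡ sxs sys xs⊆′ ys⊆′)
  where
  x≡y : x ≡ y
  x≡y with xs⊆ (here refl) | ys⊆ (here refl)
  ... | here x≡y   | _          = x≡y
  ... | there _    | here y≡x   = sym y≡x
  ... | there x∈ys | there y∈xs = ⊥-elim (ℕP.<-asym (All.lookup y<ys x∈ys) (All.lookup x<xs y∈xs))
  xs⊆′ : ∀ {z} → z ∈ xs → z ∈ ys
  xs⊆′ z∈xs with xs⊆ (there z∈xs)
  ... | here refl = ⊥-elim (ℕP.<-irrefl x≡y (All.lookup x<xs z∈xs))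
  ... | there z∈ys = z∈ys
  ys⊆′ : ∀ {z} → z ∈ ys → z ∈ xs
  ys⊆′ z∈ys with ys⊆ (there z∈ys)
  ... | here refl = ⊥-elim (ℕP.<-irrefl (sym x≡y) (All.lookup y<ys z∈ys))
  ... | there z∈xs = z∈xs

-- The set S

IsBreak : ℕ → ℕ → Set
IsBreak n k = quot n k ≢ quot n (suc k)

isBreak? : ∀ n → U.Decidable (IsBreak n)
isBreak? n k = ¬? (quot n k ≟ quot n (suc k))

InS : ℕ → ℕ → Set
InS n k = 1 ≤ k × k ≤ n × IsBreak n k

∈S⇒InS : ∀ {n k} → k ∈ Slist n → InS n k
∈S⇒InS {n} k∈S with MP.∈-filter⁻ (isBreak? n) {xs = range n} k∈S
... | k∈range , break with MP.∈-map⁻ suc k∈range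
...   | _ , i∈upTo , refl = s≤s z≤n , MP.∈-upTo⁻ i∈upTo , break

InS⇒∈S : ∀ {n k} → InS n k → k ∈ Slist n
InS⇒∈S {n} (1≤k , k≤n , break) = MP.∈-filter⁺ (isBreak? n) (∈-range⁺ 1≤k k≤n) break

S-strictlySorted : ∀ n → AllPairs _<_ (Slist n)
S-strictlySorted n = APP.filter⁺ (isBreak? n) (APP.map⁺ (APP.applyUpTo⁺₁ id n (λ i<j _ → s≤s i<j)))

quot-quot-InS : ∀ {n k} → InS n k → quot n (quot n k) ≡ k
quot-quot-InS {n} {k} (1≤k , k≤n , break) = ℕP.≤-antisym ≤k (≤quot-quot 1≤k k≤n)
  where
  v = quot n k
  1≤v : 1 ≤ v
  1≤v = quot-≥1 1≤k k≤n
  ≤k : quot n v ≤ k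
  ≤k with ℕP.≤-<-connex (quot n v) k
  ... | inj₁ ≤k = ≤k
  ... | inj₂ k< = ⊥-elim (break (ℕP.≤-antisym
          (*≤⇒≤quot (s≤s z≤n) (subst (_≤ n) (ℕP.*-comm (suc k) v) (≤quot⇒*≤ 1≤v k<)))
          (quot-antitone n 1≤k (ℕP.n≤1+n k))))

IsBreak-of-fixed : ∀ {n k} → 1 ≤ k → k ≤ n → quot n (quot n k) ≡ k → IsBreak n k
IsBreak-of-fixed {n} {k} 1≤k k≤n fixed k/≡1+k/ = ℕP.<-irrefl refl (subst (suc k ≤_) fixed
  (*≤⇒≤quot (quot-≥1 1≤k k≤n) (subst (_≤ n) (ℕP.*-comm (quot n k) (suc k))
    (subst (λ x → x ℕ.* suc k ≤ n) (sym k/≡1+k/) (≤quot⇒*≤ (s≤s z≤n) ℕP.≤-refl)))))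

InS-quot : ∀ {n k} → 1 ≤ k → k ≤ n → InS n (quot n k)
InS-quot {n} {k} 1≤k k≤n =
  1≤k/ , quot-≤ n k , IsBreak-of-fixed 1≤k/ (quot-≤ n k) (quot-quot-quot 1≤k k≤n)
  where
  1≤k/ : 1 ≤ quot n k
  1≤k/ = quot-≥1 1≤k k≤n

quot-strictAnti-InS : ∀ {n a b} → InS n a → InS n b → a < b → quot n b < quot n a
quot-strictAnti-InS {n} a∈S b∈S a<b with ℕP.m≤n⇒m<n∨m≡n (quot-antitone n (proj₁ a∈S) (ℕP.<⇒≤ a<b))
... | inj₁ lt     = lt
... | inj₂ b/≡a/ = ⊥-elim (ℕP.<⇒≢ a<b
      (trans (sym (quot-quot-InS a∈S)) (trans (cong (quot n) (sym b/≡a/)) (quot-quot-InS b∈S))))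

S-reverse : ∀ n → Slist n ≡ reverse (map (quot n) (Slist n))
S-reverse n = strictlySorted-≡ (S-strictlySorted n) sorted ⊆ ⊇
  where
  S = Slist n
  sorted : AllPairs _<_ (reverse (map (quot n) S))
  sorted = AllPairs-reverse (APP.map⁺ (AllPairs-mapWith (quot-strictAnti-InS {n})
                                                       (All.tabulate (∈S⇒InS {n})) (S-strictlySorted n)))
  ⊆ : ∀ {k} → k ∈ S → k ∈ reverse (map (quot n) S)
  ⊆ k∈S with ∈S⇒InS k∈S
  ... | k∈S′@(1≤k , k≤n , _) = AnyP.reverse⁺ (subst (_∈ map (quot n) S) (quot-quot-InS k∈S′)
                                 (MP.∈-map⁺ (quot n) (InS⇒∈S (InS-quot 1≤k k≤n))))
  ⊇ : ∀ {k} → k ∈ reverse (map (quot n) S) → k ∈ S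
  ⊇ k∈ with MP.∈-map⁻ (quot n) (AnyP.reverse⁻ k∈)
  ... | k , k∈S , refl with ∈S⇒InS k∈S
  ...   | 1≤k , k≤n , _ = InS⇒∈S (InS-quot 1≤k k≤n)

elt-InS : ∀ n (p : Fin (s n)) → InS n (elt n p)
elt-InS n p = ∈S⇒InS (nth-∈ (Slist n) (FinP.toℕ<n p))

elt-≥1 : ∀ n (p : Fin (s n)) → 1 ≤ elt n p
elt-≥1 n p = proj₁ (elt-InS n p)

elt-≤⇔ : ∀ n {p q : Fin (s n)} → elt n p ≤ elt n q ⇔ toℕ p ≤ toℕ q
elt-≤⇔ n {p} {q} = mk⇔ reflect monotone
  where
  reflect : elt n p ≤ elt n q → toℕ p ≤ toℕ q
  reflect ≤ with ℕP.≤-<-connex (toℕ p) (toℕ q)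
  ... | inj₁ p≤q = p≤q
  ... | inj₂ q<p = ⊥-elim (ℕP.<⇒≱ (nth-strictMono (S-strictlySorted n) q<p (FinP.toℕ<n p)) ≤)
  monotone : toℕ p ≤ toℕ q → elt n p ≤ elt n q
  monotone p≤q with ℕP.m≤n⇒m<n∨m≡n p≤q
  ... | inj₁ p<q = ℕP.<⇒≤ (nth-strictMono (S-strictlySorted n) p<q (FinP.toℕ<n q))
  ... | inj₂ p≡q = ℕP.≤-reflexive (cong (nth (Slist n)) p≡q)

elt-injective : ∀ n {p q : Fin (s n)} → elt n p ≡ elt n q → p ≡ q
elt-injective n e = FinP.toℕ-injective (ℕP.≤-antisym (Equivalence.to (elt-≤⇔ n) (ℕP.≤-reflexive e))
                                                      (Equivalence.to (elt-≤⇔ n) (ℕP.≤-reflexive (sym e))))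

quot-elt : ∀ n (p : Fin (s n)) → quot n (elt n p) ≡ elt n (Fin.opposite p)
quot-elt n p = begin
  quot n (nth S (toℕ p))                                  ≡⟨ cong (λ xs → quot n (nth xs (toℕ p))) (S-reverse n) ⟩
  quot n (nth (reverse (map (quot n) S)) (toℕ p))
    ≡⟨ cong (quot n) (nth-reverse (map (quot n) S) (subst (toℕ p <_) (sym (LP.length-map (quot n) S)) (FinP.toℕ<n p))) ⟩
  quot n (nth (map (quot n) S) (length (map (quot n) S) ∸ suc (toℕ p)))
    ≡⟨ cong (λ m → quot n (nth (map (quot n) S) (m ∸ suc (toℕ p)))) (LP.length-map (quot n) S) ⟩
  quot n (nth (map (quot n) S) (s n ∸ suc (toℕ p)))    ≡⟨ cong (λ i → quot n (nth (map (quot n) S) i)) (sym (FinP.opposite-prop p)) ⟩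
  quot n (nth (map (quot n) S) (toℕ (Fin.opposite p)))  ≡⟨ cong (quot n) (nth-map (quot n) S (FinP.toℕ<n (Fin.opposite p))) ⟩
  quot n (quot n (elt n (Fin.opposite p)))             ≡⟨ quot-quot-InS (elt-InS n (Fin.opposite p)) ⟩
  elt n (Fin.opposite p)                               ∎
  where
  open ≡-Reasoning
  S = Slist n

elt-*-≤⇔ : ∀ n (p q : Fin (s n)) → elt n p ℕ.* elt n q ≤ n ⇔ suc (toℕ p ℕ.+ toℕ q) ≤ s n
elt-*-≤⇔ n p q = mk⇔ to from
  where
  P = toℕ p
  Q = toℕ q
  q+1+p≡ : Q ℕ.+ suc P ≡ suc (P ℕ.+ Q)
  q+1+p≡ = trans (ℕP.+-suc Q P) (cong suc (ℕP.+-comm Q P))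
  -- s_p s_q ≤ n  ⇔  s_q ≤ n / s_p = s_{opposite p}  ⇔  Q ≤ s − 1 − P
  to : elt n p ℕ.* elt n q ≤ n → suc (P ℕ.+ Q) ≤ s n
  to le = subst (_≤ s n) q+1+p≡ (ℕP.m≤o∸n⇒m+n≤o Q (FinP.toℕ<n p)
            (subst (Q ≤_) (FinP.opposite-prop p) (Equivalence.to (elt-≤⇔ n)
              (subst (elt n q ≤_) (quot-elt n p)
                (*≤⇒≤quot (elt-≥1 n p) (subst (_≤ n) (ℕP.*-comm (elt n p) (elt n q)) le))))))
  from : suc (P ℕ.+ Q) ≤ s n → elt n p ℕ.* elt n q ≤ n
  from le = subst (_≤ n) (ℕP.*-comm (elt n q) (elt n p)) (≤quot⇒*≤ (elt-≥1 n p)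
              (subst (elt n q ≤_) (sym (quot-elt n p)) (Equivalence.from (elt-≤⇔ n)
                (subst (Q ≤_) (sym (FinP.opposite-prop p))
                  (ℕP.m+n≤o⇒m≤o∸n Q (subst (_≤ s n) (sym q+1+p≡) le))))))

lastOr0-∷ʳ : ∀ (xs : List ℕ) w → lastOr0 (xs ++ w ∷ []) ≡ w
lastOr0-∷ʳ []           w = refl
lastOr0-∷ʳ (x ∷ [])     w = refl
lastOr0-∷ʳ (x ∷ y ∷ ys) w = lastOr0-∷ʳ (y ∷ ys) w

lastOr0-filter-range : ∀ {Q : Pred ℕ 0ℓ} (Q? : U.Decidable Q) N {w} → 1 ≤ w → w ≤ N → Q w →
                       (∀ k → w < k → k ≤ N → ¬ Q k) → lastOr0 (filter Q? (range N)) ≡ w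
lastOr0-filter-range Q? zero    {suc _} _ () _ _
lastOr0-filter-range Q? (suc N) {w} 1≤w w≤N Qw none-above =
  trans (cong (λ xs → lastOr0 (filter Q? xs)) (range-suc N))
        (trans (cong lastOr0 (LP.filter-++ Q? (range N) (suc N ∷ []))) last-block)
  where
  last-block : lastOr0 (filter Q? (range N) ++ filter Q? (suc N ∷ [])) ≡ w
  last-block with ℕP.m≤n⇒m<n∨m≡n w≤N
  ... | inj₂ refl = trans (cong (λ xs → lastOr0 (filter Q? (range N) ++ xs)) (LP.filter-accept Q? {xs = []} Qw))
                          (lastOr0-∷ʳ (filter Q? (range N)) (suc N))
  ... | inj₁ w<1+N =
    trans (cong (λ xs → lastOr0 (filter Q? (range N) ++ xs))
                (LP.filter-reject Q? {xs = []} (none-above (suc N) w<1+N ℕP.≤-refl)))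
          (trans (cong lastOr0 (LP.++-identityʳ (filter Q? (range N))))
                 (lastOr0-filter-range Q? N 1≤w (ℕ.s≤s⁻¹ w<1+N) Qw
                                      (λ k w<k k≤N → none-above k w<k (ℕP.m≤n⇒m≤1+n k≤N))))

classMax-value : ∀ {n x} → 1 ≤ x → x ≤ n → classMax n x ≡ quot n (quot n x)
classMax-value {n} {x} 1≤x x≤n =
  lastOr0-filter-range (λ k → quot n k ≟ quot n x) n 1≤w (quot-≤ n v) (quot-quot-quot 1≤x x≤n) none-above
  where
  v = quot n x
  1≤v : 1 ≤ v
  1≤v = quot-≥1 1≤x x≤n
  1≤w : 1 ≤ quot n v
  1≤w = quot-≥1 1≤v (quot-≤ n x)
  none-above : ∀ k → quot n v < k → k ≤ n → quot n k ≢ v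
  none-above k w<k _ k/≡v = ℕP.<⇒≱ w<k (*≤⇒≤quot 1≤v (subst (_≤ n) (ℕP.*-comm v k)
    (≤quot⇒*≤ (ℕP.≤-trans 1≤w (ℕP.<⇒≤ w<k)) (ℕP.≤-reflexive (sym k/≡v)))))

quot-classMax : ∀ {n x} → 1 ≤ x → x ≤ n → quot n (classMax n x) ≡ quot n x
quot-classMax 1≤x x≤n rewrite classMax-value 1≤x x≤n = quot-quot-quot 1≤x x≤n

classMax-index : ∀ {n x} → 1 ≤ x → x ≤ n → Σ[ l ∈ Fin (s n) ] elt n l ≡ classMax n x
classMax-index {n} {x} 1≤x x≤n rewrite classMax-value 1≤x x≤n =
  ∈⇒nth (InS⇒∈S (InS-quot (quot-≥1 1≤x x≤n) (quot-≤ n x)))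

-- Summation over S by blocks

upFrom : ℕ → ℕ → List ℕ
upFrom c zero    = []
upFrom c (suc k) = c ∷ upFrom (suc c) k

range≡upFrom : ∀ n → range n ≡ upFrom 1 n
range≡upFrom n = trans (LP.map-upTo suc n) (applyUpTo-shift suc n (λ i → refl))
  where
  applyUpTo-shift : ∀ {c} (g : ℕ → ℕ) k → (∀ i → g i ≡ c ℕ.+ i) → applyUpTo g k ≡ upFrom c k
  applyUpTo-shift {c} g zero    g≗ = refl
  applyUpTo-shift {c} g (suc k) g≗ = cong₂ _∷_ (trans (g≗ 0) (ℕP.+-identityʳ c))
    (applyUpTo-shift (g ∘ suc) k (λ i → trans (g≗ (suc i)) (ℕP.+-suc c i)))

consecutiveSum : (ℕ → ℕ → ℤ) → ℕ → List ℕ → ℤ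
consecutiveSum G a []       = + 0
consecutiveSum G a (c ∷ cs) = G a c + consecutiveSum G c cs

ΣF-consecutive : ∀ (G : ℕ → ℕ → ℤ) a xs →
                 ΣF (length xs) (λ r → G (nth (a ∷ xs) (toℕ r)) (nth xs (toℕ r))) ≡ consecutiveSum G a xs
ΣF-consecutive G a []       = refl
ΣF-consecutive G a (x ∷ xs) = cong (_+_ (G a x)) (ΣF-consecutive G x xs)

module Blocks {P : Pred ℕ 0ℓ} (P? : U.Decidable P) (f h : ℕ → ℤ) (h-step : ∀ m → ¬ P m → h m ≡ h (suc m)) where

  open ≡-Reasoning

  private
    fh : ℕ → ℤ
    fh m = f m * h m

  block : ℕ → ℕ → ℤ
  block a c = (Σ≤ c f - Σ≤ a f) * h c

  Gap : ℕ → ℕ → Set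
  Gap a c = ∀ m → a < m → m < c → ¬ P m

  constant-on-gap : ∀ {a} c → Gap a c → ∀ m → a < m → m ≤ c → h m ≡ h c
  constant-on-gap {a} zero    gap m a<m m≤0 = ⊥-elim (ℕP.<⇒≱ (ℕP.≤-<-trans z≤n a<m) m≤0)
  constant-on-gap {a} (suc c) gap m a<m m≤1+c with ℕP.m≤n⇒m<n∨m≡n m≤1+c
  ... | inj₂ refl = refl
  ... | inj₁ m<1+c =
    trans (constant-on-gap c (λ k a<k k<c → gap k a<k (ℕP.m<n⇒m<1+n k<c)) m a<m (ℕ.s≤s⁻¹ m<1+c))
          (h-step c (gap c (ℕP.<-≤-trans a<m (ℕ.s≤s⁻¹ m<1+c)) (ℕP.n<1+n c)))

  block-gap : ∀ {a c} → a ≤ c → Gap a c → block a c ≡ Σ≤ c fh - Σ≤ a fh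
  block-gap {a} {c} a≤c gap = begin
    (Σ≤ c f - Σ≤ a f) * h c                              ≡⟨ cong (_* h c) (Σ≤-interval f a≤c) ⟩
    Σ≤ (c ∸ a) (λ i → f (a ℕ.+ i)) * h c                ≡⟨ sym (*-distribʳ-Σ≤ (c ∸ a) (h c) _) ⟩
    Σ≤ (c ∸ a) (λ i → f (a ℕ.+ i) * h c)
      ≡⟨ Σ≤-cong (c ∸ a) (λ i 1≤i i≤c-a → cong (f (a ℕ.+ i) *_) (sym (h≡ i 1≤i i≤c-a))) ⟩
    Σ≤ (c ∸ a) (λ i → fh (a ℕ.+ i))                     ≡⟨ sym (Σ≤-interval fh a≤c) ⟩
    Σ≤ c fh - Σ≤ a fh                                   ∎
    where
    h≡ : ∀ i → 1 ≤ i → i ≤ c ∸ a → h (a ℕ.+ i) ≡ h c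
    h≡ i 1≤i i≤c-a = constant-on-gap c gap (a ℕ.+ i)
      (subst (_≤ a ℕ.+ i) (ℕP.+-comm a 1) (ℕP.+-monoʳ-≤ a 1≤i))
      (subst (a ℕ.+ i ≤_) (ℕP.m+[n∸m]≡n a≤c) (ℕP.+-monoʳ-≤ a i≤c-a))

  consecutiveSum-filter : ∀ k c {a} → a < c → Gap a c → P (c ℕ.+ k) →
    consecutiveSum block a (filter P? (upFrom c (suc k))) ≡ Σ≤ (c ℕ.+ k) fh - Σ≤ a fh
  consecutiveSum-filter k c {a} a<c gap P[c+k] with P? c
  ... | yes Pc = from-c k P[c+k]
    where
    from-c : ∀ k → P (c ℕ.+ k) →
             block a c + consecutiveSum block c (filter P? (upFrom (suc c) k)) ≡ Σ≤ (c ℕ.+ k) fh - Σ≤ a fh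
    from-c zero    _ rewrite ℕP.+-identityʳ c = trans (ℤP.+-identityʳ _) (block-gap (ℕP.<⇒≤ a<c) gap)
    from-c (suc k) P[c+1+k] rewrite ℕP.+-suc c k = begin
      block a c + consecutiveSum block c (filter P? (upFrom (suc c) (suc k)))
        ≡⟨ cong₂ _+_ (block-gap (ℕP.<⇒≤ a<c) gap)
                     (consecutiveSum-filter k (suc c) (ℕP.n<1+n c) (λ m c<m m<1+c → ⊥-elim (ℕP.<⇒≱ m<1+c c<m))
                                           P[c+1+k]) ⟩
      (Σ≤ c fh - Σ≤ a fh) + (Σ≤ (suc c ℕ.+ k) fh - Σ≤ c fh) ≡⟨ telescope (Σ≤ a fh) (Σ≤ c fh) (Σ≤ (suc (c ℕ.+ k)) fh) ⟩
      Σ≤ (suc (c ℕ.+ k)) fh - Σ≤ a fh ∎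
      where
      telescope : ∀ x y z → (y - x) + (z - y) ≡ z - x
      telescope = solve-∀
  ... | no ¬Pc = skip-c k P[c+k]
    where
    skip-c : ∀ k → P (c ℕ.+ k) →
             consecutiveSum block a (filter P? (upFrom (suc c) k)) ≡ Σ≤ (c ℕ.+ k) fh - Σ≤ a fh
    skip-c zero    P[c+0] = ⊥-elim (¬Pc (subst P (ℕP.+-identityʳ c) P[c+0]))
    skip-c (suc k) P[c+1+k] rewrite ℕP.+-suc c k =
      consecutiveSum-filter k (suc c) (ℕP.m<n⇒m<1+n a<c) gap′ P[c+1+k]
      where
      gap′ : Gap a (suc c)
      gap′ m a<m m<1+c with ℕP.m≤n⇒m<n∨m≡n (ℕ.s≤s⁻¹ m<1+c)
      ... | inj₁ m<c = gap m a<m m<c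
      ... | inj₂ refl = ¬Pc

pre≡nth : ∀ n (p : Fin (s n)) → pre n p ≡ nth (0 ∷ Slist n) (toℕ p)
pre≡nth n p with toℕ p
... | zero  = refl
... | suc _ = refl

IsBreak-self : ∀ {n} → 1 ≤ n → IsBreak n n
IsBreak-self {n} 1≤n n/n≡ = ℕP.1+n≢0 (trans (sym (quot-self 1≤n)) (trans n/n≡ (quot-< (ℕP.n<1+n n))))

ΣF-S-blocks : ∀ n → 1 ≤ n → (f H : ℕ → ℤ) →
  ΣF (s n) (λ r → (Σ≤ (elt n r) f - Σ≤ (pre n r) f) * H (quot n (elt n r))) ≡ Σ≤ n (λ m → f m * H (quot n m))
ΣF-S-blocks n@(suc n′) 1≤n f H = begin
  ΣF (s n) (λ r → (Σ≤ (elt n r) f - Σ≤ (pre n r) f) * h (elt n r))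
    ≡⟨ ΣF-cong (s n) (λ r → cong (λ x → (Σ≤ (elt n r) f - Σ≤ x f) * h (elt n r)) (pre≡nth n r)) ⟩
  ΣF (length (Slist n)) (λ r → block (nth (0 ∷ Slist n) (toℕ r)) (nth (Slist n) (toℕ r)))
    ≡⟨ ΣF-consecutive block 0 (Slist n) ⟩
  consecutiveSum block 0 (filter (isBreak? n) (range n))
    ≡⟨ cong (λ xs → consecutiveSum block 0 (filter (isBreak? n) xs)) (range≡upFrom n) ⟩
  consecutiveSum block 0 (filter (isBreak? n) (upFrom 1 n))
    ≡⟨ consecutiveSum-filter n′ 1 (s≤s z≤n) (λ m 0<m m<1 → ⊥-elim (ℕP.<⇒≱ 0<m (ℕ.s≤s⁻¹ m<1))) (IsBreak-self 1≤n) ⟩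
  Σ≤ n (λ m → f m * h m) - + 0
    ≡⟨ ℤP.+-identityʳ _ ⟩
  Σ≤ n (λ m → f m * H (quot n m)) ∎
  where
  open ≡-Reasoning
  h : ℕ → ℤ
  h m = H (quot n m)
  h-step : ∀ m → ¬ IsBreak n m → h m ≡ h (suc m)
  h-step m ¬break = cong H (decidable-stable (quot n m ≟ quot n (suc m)) ¬break)
  open Blocks (isBreak? n) f h h-step

-- Multiplication matrices of 𝒜

ρ-entry : ∀ n (a : Elem n) l q → ρ n a l q ≡ ΣF (s n) (λ r → a r * mulCoeff n r q l)
ρ-entry n a l q = ΣF-cong (s n) (λ r →
  trans (ΣF-single (s n) q (λ q′ q′≢q → trans (cong (λ x → a r * x * mulCoeff n r q′ l) (Id-off (q′≢q ∘ sym)))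
                                            (zero-middle (a r) (mulCoeff n r q′ l))))
        (trans (cong (λ x → a r * x * mulCoeff n r q l) (Id-diag q)) (one-middle (a r) (mulCoeff n r q l))))
  where
  zero-middle : ∀ x y → x * + 0 * y ≡ + 0
  zero-middle = solve-∀
  one-middle : ∀ x y → x * + 1 * y ≡ x * y
  one-middle = solve-∀

-- 𝐫𝐪 is the basis vector of the class of s_r s_q (or 0 if s_r s_q > n), and this class
-- has the same ⌊n/·⌋ as s_r s_q.
ΣF-mulCoeff : ∀ n (φ : ℕ → ℤ) → φ 0 ≡ + 0 → ∀ r q →
              ΣF (s n) (λ l → φ (quot n (elt n l)) * mulCoeff n r q l) ≡ φ (quot n (elt n r ℕ.* elt n q))
ΣF-mulCoeff n φ φ0≡0 r q = by-cases (x ≤? n)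
  where
  open ≡-Reasoning
  x = elt n r ℕ.* elt n q
  1≤x : 1 ≤ x
  1≤x = ℕP.*-mono-≤ (elt-≥1 n r) (elt-≥1 n q)
  coeff? : ∀ l → Dec (x ≤ n × classMax n x ≡ elt n l)
  coeff? l = (x ≤? n) ×-dec (classMax n x ≟ elt n l)
  by-cases : Dec (x ≤ n) → ΣF (s n) (λ l → φ (quot n (elt n l)) * mulCoeff n r q l) ≡ φ (quot n x)
  by-cases (no x≰n) =
    trans (ΣF-zero (s n) (λ l → trans (cong (φ (quot n (elt n l)) *_) (𝟙-no (coeff? l) (x≰n ∘ proj₁)))
                                      (ℤP.*-zeroʳ (φ (quot n (elt n l))))))
          (sym (trans (cong φ (quot-< (ℕP.≰⇒> x≰n))) φ0≡0))
  by-cases (yes x≤n) with classMax-index 1≤x x≤n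
  ... | l₀ , l₀≡max = begin
    ΣF (s n) (λ l → φ (quot n (elt n l)) * mulCoeff n r q l)
      ≡⟨ ΣF-single (s n) l₀ (λ l l≢l₀ → trans (cong (φ (quot n (elt n l)) *_)
                                                     (𝟙-no (coeff? l) (l≢l₀ ∘ l≡l₀ l ∘ proj₂)))
                                              (ℤP.*-zeroʳ (φ (quot n (elt n l))))) ⟩
    φ (quot n (elt n l₀)) * mulCoeff n r q l₀
      ≡⟨ trans (cong (φ (quot n (elt n l₀)) *_) (𝟙-yes (coeff? l₀) (x≤n , sym l₀≡max))) (ℤP.*-identityʳ _) ⟩
    φ (quot n (elt n l₀))
      ≡⟨ cong φ (trans (cong (quot n) l₀≡max) (quot-classMax 1≤x x≤n)) ⟩
    φ (quot n x) ∎
    where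
    l≡l₀ : ∀ l → classMax n x ≡ elt n l → l ≡ l₀
    l≡l₀ l max≡l = elt-injective n (trans (sym max≡l) (sym l₀≡max))

⊗ρ-entry : ∀ n (G : Mat (s n)) (a : Elem n) {p} (φ : ℕ → ℤ) → φ 0 ≡ + 0 →
           (∀ l → G p l ≡ φ (quot n (elt n l))) →
           ∀ q → (G ⊗ ρ n a) p q ≡ ΣF (s n) (λ r → a r * φ (quot n (elt n r ℕ.* elt n q)))
⊗ρ-entry n G a {p} φ φ0≡0 G≡φ q = begin
  ΣF k (λ l → G p l * ρ n a l q)
    ≡⟨ ΣF-cong k (λ l → cong₂ _*_ (G≡φ l) (ρ-entry n a l q)) ⟩
  ΣF k (λ l → g l * ΣF k (λ r → a r * mulCoeff n r q l))
    ≡⟨ ΣF-cong k (λ l → sym (*-distribˡ-ΣF k (g l) _)) ⟩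
  ΣF k (λ l → ΣF k (λ r → g l * (a r * mulCoeff n r q l)))
    ≡⟨ ΣF-comm k k _ ⟩
  ΣF k (λ r → ΣF k (λ l → g l * (a r * mulCoeff n r q l)))
    ≡⟨ ΣF-cong k (λ r → trans (ΣF-cong k (λ l → swap (g l) (a r) (mulCoeff n r q l))) (*-distribˡ-ΣF k (a r) _)) ⟩
  ΣF k (λ r → a r * ΣF k (λ l → g l * mulCoeff n r q l))
    ≡⟨ ΣF-cong k (λ r → cong (a r *_) (ΣF-mulCoeff n φ φ0≡0 r q)) ⟩
  ΣF k (λ r → a r * φ (quot n (elt n r ℕ.* elt n q))) ∎
  where
  open ≡-Reasoning
  k = s n
  g : Fin k → ℤ
  g l = φ (quot n (elt n l))
  swap : ∀ x y z → x * (y * z) ≡ y * (x * z)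
  swap = solve-∀

T-entry : ∀ n (p l : Fin (s n)) → T n p l ≡ 𝟙 (elt n p ≤? quot n (elt n l))
T-entry n p l = 𝟙-cong (suc (toℕ p ℕ.+ toℕ l) ≤? s n) (elt n p ≤? quot n (elt n l))
  (*≤⇒≤quot (elt-≥1 n l) ∘ Equivalence.from (elt-*-≤⇔ n p l))
  (Equivalence.to (elt-*-≤⇔ n p l) ∘ ≤quot⇒*≤ (elt-≥1 n l))

Tρ-entry : ∀ n (a : Elem n) p q →
           (T n ⊗ ρ n a) p q ≡ ΣF (s n) (λ r → a r * 𝟙 (elt n p ≤? quot n (elt n r ℕ.* elt n q)))
Tρ-entry n a p = ⊗ρ-entry n (T n) a (λ v → 𝟙 (elt n p ≤? v)) (𝟙-no (elt n p ≤? 0) (ℕP.<⇒≱ (elt-≥1 n p))) (T-entry n p)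

Tρ-symmetric : ∀ n (a : Elem n) → Symmetric (T n ⊗ ρ n a)
Tρ-symmetric n a p q = begin
  (T n ⊗ ρ n a) p q                                                  ≡⟨ Tρ-entry n a p q ⟩
  ΣF (s n) (λ r → a r * 𝟙 (elt n p ≤? quot n (elt n r ℕ.* elt n q)))  ≡⟨ ΣF-cong (s n) (λ r → cong (a r *_) (swap r)) ⟩
  ΣF (s n) (λ r → a r * 𝟙 (elt n q ≤? quot n (elt n r ℕ.* elt n p)))  ≡⟨ sym (Tρ-entry n a q p) ⟩
  (T n ⊗ ρ n a) q p                                                  ∎
  where
  open ≡-Reasoning
  swap : ∀ r → 𝟙 (elt n p ≤? quot n (elt n r ℕ.* elt n q)) ≡ 𝟙 (elt n q ≤? quot n (elt n r ℕ.* elt n p))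
  swap r rewrite sym (quot-quot n (elt-≥1 n r) (elt-≥1 n q)) | sym (quot-quot n (elt-≥1 n r) (elt-≥1 n p)) =
    𝟙-cong (elt n p ≤? _) (elt n q ≤? _) (≤quot-swap (elt-≥1 n p) (elt-≥1 n q)) (≤quot-swap (elt-≥1 n q) (elt-≥1 n p))

-- The matrices 𝒰 and ℳ

mertens≡Σ≤ : ∀ x → mertens x ≡ Σ≤ x möbius
mertens≡Σ≤ zero    = refl
mertens≡Σ≤ (suc x) = cong (_+ möbius (suc x)) (mertens≡Σ≤ x)

𝒰-entry : ∀ n → 1 ≤ n → ∀ p q → 𝒰 n p q ≡ + quot n (elt n p ℕ.* elt n q)
𝒰-entry n 1≤n p q = begin
  𝒰 n p q
    ≡⟨ Tρ-entry n (uvec n) p q ⟩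
  ΣF (s n) (λ r → uvec n r * 𝟙 (sp ≤? quot n (elt n r ℕ.* sq)))
    ≡⟨ ΣF-cong (s n) (λ r → cong₂ _*_ (cong₂ _-_ (sym (Σ≤-const-1 (elt n r))) (sym (Σ≤-const-1 (pre n r))))
                                      (cong (λ x → 𝟙 (sp ≤? x)) (sym (quot-quot n (elt-≥1 n r) 1≤sq)))) ⟩
  ΣF (s n) (λ r → (Σ≤ (elt n r) one - Σ≤ (pre n r) one) * H (quot n (elt n r)))
    ≡⟨ ΣF-S-blocks n 1≤n one H ⟩
  Σ≤ n (λ m → + 1 * H (quot n m))
    ≡⟨ Σ≤-cong n (λ m 1≤m _ → trans (ℤP.*-identityˡ _) (count-term m 1≤m)) ⟩
  Σ≤ n (λ m → 𝟙 (m ≤? quot (quot n sq) sp))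
    ≡⟨ Σ≤-count (ℕP.≤-trans (quot-≤ (quot n sq) sp) (quot-≤ n sq)) ⟩
  + quot (quot n sq) sp
    ≡⟨ cong +_ (trans (quot-quot n 1≤sq 1≤sp) (cong (quot n) (ℕP.*-comm sq sp))) ⟩
  + quot n (sp ℕ.* sq) ∎
  where
  open ≡-Reasoning
  sp = elt n p
  sq = elt n q
  1≤sp : 1 ≤ sp
  1≤sp = elt-≥1 n p
  1≤sq : 1 ≤ sq
  1≤sq = elt-≥1 n q
  one H : ℕ → ℤ
  one _ = + 1
  H v = 𝟙 (sp ≤? quot v sq)
  count-term : ∀ m → 1 ≤ m → H (quot n m) ≡ 𝟙 (m ≤? quot (quot n sq) sp)
  count-term m 1≤m rewrite quot-quot-comm n 1≤m 1≤sq =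
    𝟙-cong (sp ≤? _) (m ≤? _) (≤quot-swap 1≤sp 1≤m) (≤quot-swap 1≤m 1≤sp)

𝒰⊗ρμ≈T : ∀ n → 1 ≤ n → (𝒰 n ⊗ ρ n (μvec n)) ≈M T n
𝒰⊗ρμ≈T n 1≤n p q = begin
  (𝒰 n ⊗ ρ n (μvec n)) p q
    ≡⟨ ⊗ρ-entry n (𝒰 n) (μvec n) (λ v → + quot v sp) (cong +_ (quot-< (elt-≥1 n p))) 𝒰-row q ⟩
  ΣF (s n) (λ r → μvec n r * + quot (quot n (elt n r ℕ.* sq)) sp)
    ≡⟨ ΣF-cong (s n) (λ r → cong₂ _*_ (cong₂ _-_ (mertens≡Σ≤ (elt n r)) (mertens≡Σ≤ (pre n r)))
                                      (cong (λ x → + quot x sp) (sym (quot-quot n (elt-≥1 n r) 1≤sq)))) ⟩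
  ΣF (s n) (λ r → (Σ≤ (elt n r) möbius - Σ≤ (pre n r) möbius) * H (quot n (elt n r)))
    ≡⟨ ΣF-S-blocks n 1≤n möbius H ⟩
  Σ≤ n (λ m → möbius m * H (quot n m))
    ≡⟨ Σ≤-cong n (λ m 1≤m _ → cong (λ x → möbius m * + x) (regroup m 1≤m)) ⟩
  Σ≤ n (λ m → möbius m * + quot X m)
    ≡⟨ Σ≤-truncate X n (quot-≤ n (sp ℕ.* sq)) (λ m X<m _ → trans (cong (λ x → möbius m * + x) (quot-< X<m))
                                                                 (ℤP.*-zeroʳ (möbius m))) ⟩
  Σ≤ X (λ m → möbius m * + quot X m)
    ≡⟨ Σ≤-möbius-quot X ⟩
  𝟙 (1 ≤? X)
    ≡⟨ 𝟙-cong (1 ≤? X) (suc (toℕ p ℕ.+ toℕ q) ≤? s n)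
              (Equivalence.to (elt-*-≤⇔ n p q) ∘ subst (_≤ n) (ℕP.*-identityˡ _) ∘ ≤quot⇒*≤ 1≤sp*sq)
              (*≤⇒≤quot 1≤sp*sq ∘ subst (_≤ n) (sym (ℕP.*-identityˡ _)) ∘ Equivalence.from (elt-*-≤⇔ n p q)) ⟩
  T n p q ∎
  where
  open ≡-Reasoning
  sp = elt n p
  sq = elt n q
  1≤sp : 1 ≤ sp
  1≤sp = elt-≥1 n p
  1≤sq : 1 ≤ sq
  1≤sq = elt-≥1 n q
  1≤sp*sq : 1 ≤ sp ℕ.* sq
  1≤sp*sq = ℕP.*-mono-≤ 1≤sp 1≤sq
  X = quot n (sp ℕ.* sq)
  H : ℕ → ℤ
  H v = + quot (quot v sq) sp
  𝒰-row : ∀ l → 𝒰 n p l ≡ + quot (quot n (elt n l)) sp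
  𝒰-row l = trans (𝒰-entry n 1≤n p l)
                  (cong +_ (trans (cong (quot n) (ℕP.*-comm sp (elt n l))) (sym (quot-quot n (elt-≥1 n l) 1≤sp))))
  regroup : ∀ m → 1 ≤ m → quot (quot (quot n m) sq) sp ≡ quot X m
  regroup m 1≤m = trans (quot-quot (quot n m) 1≤sq 1≤sp)
                  (trans (quot-quot-comm n 1≤m (ℕP.*-mono-≤ 1≤sq 1≤sp))
                         (cong (λ x → quot (quot n x) m) (ℕP.*-comm sq sp)))

proposition6 : (n : ℕ) → 1 ≤ n →
    Symmetric (𝒰 n) × Symmetric (ℳ n) ×
    (Σ[ V ∈ Mat (s n) ] ((𝒰 n ⊗ V) ≈M Id × (V ⊗ 𝒰 n) ≈M Id × ℳ n ≈M ((T n ⊗ V) ⊗ T n)))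
proposition6 n 1≤n =
  𝒰-symmetric , ℳ-symmetric , V , 𝒰⊗V≈Id , inverseˡ-of-symmetric 𝒰-symmetric V-symmetric 𝒰⊗V≈Id , ℳ≈T⊗V⊗T
  where
  open Setoid (Mat-setoid (s n)) using () renaming (sym to ≈-sym)
  open import Relation.Binary.Reasoning.Setoid (Mat-setoid (s n))
  W = 𝕋⁻¹ (s n)
  V = (W ⊗ ℳ n) ⊗ W
  𝒰-symmetric : Symmetric (𝒰 n)
  𝒰-symmetric = Tρ-symmetric n (uvec n)
  ℳ-symmetric : Symmetric (ℳ n)
  ℳ-symmetric = Tρ-symmetric n (μvec n)
  V-symmetric : Symmetric V
  V-symmetric = ⊗-sandwich-symmetric (𝕋⁻¹-symmetric (s n)) ℳ-symmetric
  𝒰⊗V≈Id : (𝒰 n ⊗ V) ≈M Id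
  𝒰⊗V≈Id = begin
    𝒰 n ⊗ ((W ⊗ ℳ n) ⊗ W)     ≈⟨ ≈-sym (⊗-assoc (𝒰 n) (W ⊗ ℳ n) W) ⟩
    (𝒰 n ⊗ (W ⊗ ℳ n)) ⊗ W     ≈⟨ ⊗-congˡ W (⊗-congʳ (𝒰 n) (⊗-cancelˡ W (T n) (ρ n (μvec n)) (𝕋-inverseˡ (s n)))) ⟩
    (𝒰 n ⊗ ρ n (μvec n)) ⊗ W  ≈⟨ ⊗-congˡ W (𝒰⊗ρμ≈T n 1≤n) ⟩
    T n ⊗ W                   ≈⟨ 𝕋-inverseʳ (s n) ⟩
    Id                        ∎
  ℳ≈T⊗V⊗T : ℳ n ≈M ((T n ⊗ V) ⊗ T n)
  ℳ≈T⊗V⊗T = ≈-sym (begin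
    (T n ⊗ ((W ⊗ ℳ n) ⊗ W)) ⊗ T n  ≈⟨ ⊗-congˡ (T n) (≈-sym (⊗-assoc (T n) (W ⊗ ℳ n) W)) ⟩
    ((T n ⊗ (W ⊗ ℳ n)) ⊗ W) ⊗ T n  ≈⟨ ⊗-congˡ (T n) (⊗-congˡ W (⊗-cancelˡ (T n) W (ℳ n) (𝕋-inverseʳ (s n)))) ⟩
    (ℳ n ⊗ W) ⊗ T n                ≈⟨ ⊗-cancelʳ W (T n) (ℳ n) (𝕋-inverseˡ (s n)) ⟩
    ℳ n                            ∎)
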